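{- Let $u_1,u_2,u_3,c\in\mathbb{Z}_3$ with $v_3(c)>0$ be such that the cubic $u_1X^3+u_2Y^3+u_3Z^3-cXYZ=0$ is $3$-reduced (so $\min v_3(u_i)=0$ and $v_3(u_1u_2u_3)\le2$), and assume $0=v_3(u_1)\le v_3(u_2)\le v_3(u_3)$. Then, concerning nontrivial solutions in $\mathbb{Q}_3$: (1) If $v_3(c)\ge2$ and $v_3(u_1u_2u_3)=0$, the cubic is soluble if and only if $u_i\equiv\pm u_j\pmod 9$ for some $i\ne j$. (2) If $v_3(c)\ge2$, $v_3(u_2)=0$ and $v_3(u_3)>0$, it is soluble if and only if either $u_1\equiv\pm u_2\pmod9$ or $v_3(u_3)=1$. (3) If $v_3(c)\ge2$ and $v_3(u_2)=v_3(u_3)=1$, it is soluble if and only if $u_2/3\equiv\pm u_3/3\pmod9$. (4) If $v_3(c)=1$, $v_3(u_2)=0$ and $v_3(u_3)>0$, it is soluble if and only if either $u_1\equiv\pm u_2\pmod9$, or there exist $s_1,s_2\in\{ -1,1\}$ with $c\equiv s_1u_1+s_2u_2+s_1s_2u_3\pmod 9$. (5) If $v_3(c)=1$ and $v_3(u_2)=v_3(u_3)=1$, it is soluble.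
   Context: The cubic with $3$-integral coefficients is $3$-reduced if $\min(v_3(u_1),v_3(u_2),v_3(u_3))=0$ and, if $3\mid c$, $v_3(u_1u_2u_3)\le 2$. -}

module Defs where

open import Data.Nat using (ℕ; zero; suc; _+_; _*_; _^_; _<_; _≤_)
open import Data.Nat.DivMod using (_%_; _/_)
open import Data.Nat.Properties using (m^n≢0)
open import Data.Integer as ℤ using (ℤ; +_)
open import Data.Integer.Divisibility using () renaming (_∣_ to _∣ℤ_)
open import Data.Product using (Σ; _×_; ∃; ∃-syntax)
open import Data.Sum using (_⊎_)
open import Relation.Binary.PropositionalEquality using (_≡_; _≢_)

red : ℕ → ℕ → ℕ
red k a = _%_ a (3 ^ k) {{m^n≢0 3 k}}

-- The 3-adic integers Z_3 as the inverse limit of Z/3^k Z: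
-- a sequence of canonical residues  seq k ∈ {0,…,3^k - 1}  that are compatible.
record ℤ₃ : Set where
  field
    seq : ℕ → ℕ
    bounded : ∀ k → seq k < 3 ^ k
    coherent : ∀ k → red k (seq (suc k)) ≡ seq k
open ℤ₃ public

HasVal : (ℕ → ℕ) → ℕ → Set
HasVal s n = (red n (s n) ≡ 0) × (red (suc n) (s (suc n)) ≢ 0)

ValGE : ℤ₃ → ℕ → Set
ValGE u n = seq u n ≡ 0

prod3 : ℤ₃ → ℤ₃ → ℤ₃ → ℕ → ℕ
prod3 a b d k = red k (seq a k * (seq b k * seq d k))

Solves : (u1 u2 u3 c x y z : ℤ₃) → Set
Solves u1 u2 u3 c x y z = ∀ k →
  red k (seq u1 k * seq x k ^ 3 + seq u2 k * seq y k ^ 3 + seq u3 k * seq z k ^ 3)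
    ≡ red k (seq c k * (seq x k * (seq y k * seq z k)))

Nontrivial : ℤ₃ → ℤ₃ → ℤ₃ → Set
Nontrivial x y z = ∃[ k ] ((seq x k ≢ 0) ⊎ (seq y k ≢ 0) ⊎ (seq z k ≢ 0))

-- The cubic u1 X^3 + u2 Y^3 + u3 Z^3 - c X Y Z = 0 has a nontrivial solution
-- (in Z_3, equivalently in Q_3 by clearing denominators).
Soluble : (u1 u2 u3 c : ℤ₃) → Set
Soluble u1 u2 u3 c = ∃[ x ] ∃[ y ] ∃[ z ] (Nontrivial x y z × Solves u1 u2 u3 c x y z)

_≡₉_ : ℤ → ℤ → Set
a ≡₉ b = (+ 9) ∣ℤ (a ℤ.- b)

_≡±₉_ : ℤ → ℤ → Set
a ≡±₉ b = (a ≡₉ b) ⊎ (a ≡₉ (ℤ.- b))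

r9 : ℤ₃ → ℤ
r9 u = + (seq u 2)

-- residue of u/3 modulo 9 (meaningful when v_3(u) ≥ 1): (u mod 27) / 3
r9/3 : ℤ₃ → ℤ
r9/3 u = + (seq u 3 / 3)

IsSign : ℤ → Set
IsSign s = (s ≡ + 1) ⊎ (s ≡ ℤ.- (+ 1))

module Submission where

-- Necessity.  A nontrivial 3-adic solution, divided by the common power of 3 of its
-- coordinates, gives a primitive solution modulo 27 (Soluble⇒Primitive).  Reduced modulo 3,
-- 9 or 27, where a cube only depends on its base modulo 3, it leaves finitely many residue
-- configurations; these are settled by exhaustive evaluation (the opaque residue facts).
-- Sufficiency.  Each condition provides a simple root modulo 3^(e+1), e ∈ {1, 2}: a root whose
-- derivative in the third variable has valuation exactly e (SimpleRoot).  A general Hensel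
-- lemma (module HenselLifting, one pigeonhole step among three corrections at a time),
-- applied to the cubic in its third variable (module ThirdVariable), lifts it to a 3-adic
-- solution (SimpleRoot⇒Soluble).

open import Data.Nat as ℕ using (ℕ; zero; suc; NonZero; _^_; _<_; _≤_; _>_; z≤n; s≤s)
import Data.Nat.Properties as ℕP
open import Data.Nat.DivMod using (_%_; _/_; m%n<n; m<n⇒m%n≡m; m%n%n≡m%n; m∣n⇒o%n%m≡o%m; [m+kn]%n≡m%n; m≡m%n+[m/n]*n; m*n%n≡0)
import Data.Nat.Divisibility as ℕ∣
open import Data.Integer as ℤ using (ℤ; +_; -[1+_]; _+_; _*_; _-_; -_)
import Data.Integer.Properties as ℤP
import Data.Integer.DivMod as ℤD
open import Data.Integer.Divisibility.Signed as S using (divides; _∣?_) renaming (_∣_ to _∣ₛ_)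
open import Data.Integer.Tactic.RingSolver
open import Relation.Binary.PropositionalEquality
open import Relation.Nullary using (¬_; Dec; yes; no; ¬?)
open import Relation.Nullary.Decidable using (toWitness; map′; _×-dec_; _⊎-dec_; _→-dec_)
open import Data.Empty using (⊥; ⊥-elim)
open import Data.Unit using (tt)
open import Data.Product using (Σ; ∃; ∃-syntax; _×_; _,_; proj₁; proj₂)
open import Data.Sum using (_⊎_; inj₁; inj₂) renaming (map to ⊎-map)
open import Function.Bundles using (_⇔_; mk⇔; Equivalence)
open import Defs

-- Congruence of integers modulo m: a ≈[ m ] b  iff  m ∣ a - b.
-- (A record, so that the modulus is recoverable by unification.)
infix 4 _≈[_]_
record _≈[_]_ (a m b : ℤ) : Set where
  constructor mk≈
  field un≈ : m ∣ₛ (a - b)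
open _≈[_]_ public

module _ where
  private
    diff-refl : ∀ a → a - a ≡ + 0
    diff-refl = solve-∀
    diff-sym : ∀ a b → b - a ≡ - (a - b)
    diff-sym = solve-∀
    diff-trans : ∀ a b c → a - c ≡ (a - b) + (b - c)
    diff-trans = solve-∀
    diff-+ : ∀ a b a' b' → (a + b) - (a' + b') ≡ (a - a') + (b - b')
    diff-+ = solve-∀
    diff-* : ∀ a b a' b' → a * b - a' * b' ≡ (a - a') * b + a' * (b - b')
    diff-* = solve-∀
    diff-neg : ∀ a a' → (- a) - (- a') ≡ - (a - a')
    diff-neg = solve-∀
    diff-0 : ∀ a → a - + 0 ≡ a
    diff-0 = solve-∀

  ≈-refl : ∀ {m} a → a ≈[ m ] a
  ≈-refl {m} a = mk≈ (subst (m ∣ₛ_) (sym (diff-refl a)) (divides (+ 0) refl))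

  ≈-sym : ∀ {m a b} → a ≈[ m ] b → b ≈[ m ] a
  ≈-sym {m} {a} {b} (mk≈ p) = mk≈ (subst (m ∣ₛ_) (sym (diff-sym a b)) (S.∣m⇒∣-m p))

  ≈-trans : ∀ {m a b c} → a ≈[ m ] b → b ≈[ m ] c → a ≈[ m ] c
  ≈-trans {m} {a} {b} {c} (mk≈ p) (mk≈ q) =
    mk≈ (subst (m ∣ₛ_) (sym (diff-trans a b c)) (S.∣m∣n⇒∣m+n p q))

  ≈-+ : ∀ {m a b a' b'} → a ≈[ m ] a' → b ≈[ m ] b' → a + b ≈[ m ] a' + b'
  ≈-+ {m} {a} {b} {a'} {b'} (mk≈ p) (mk≈ q) =
    mk≈ (subst (m ∣ₛ_) (sym (diff-+ a b a' b')) (S.∣m∣n⇒∣m+n p q))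

  ≈-* : ∀ {m a b a' b'} → a ≈[ m ] a' → b ≈[ m ] b' → a * b ≈[ m ] a' * b'
  ≈-* {m} {a} {b} {a'} {b'} (mk≈ p) (mk≈ q) =
    mk≈ (subst (m ∣ₛ_) (sym (diff-* a b a' b')) (S.∣m∣n⇒∣m+n (S.∣m⇒∣m*n b p) (S.∣n⇒∣m*n a' q)))

  ≈-neg : ∀ {m a a'} → a ≈[ m ] a' → - a ≈[ m ] - a'
  ≈-neg {m} {a} {a'} (mk≈ p) = mk≈ (subst (m ∣ₛ_) (sym (diff-neg a a')) (S.∣m⇒∣-m p))

  ≈-- : ∀ {m a b a' b'} → a ≈[ m ] a' → b ≈[ m ] b' → a - b ≈[ m ] a' - b'
  ≈-- p q = ≈-+ p (≈-neg q)

  ≈-weaken : ∀ {m n a b} → m ∣ₛ n → a ≈[ n ] b → a ≈[ m ] b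
  ≈-weaken d (mk≈ p) = mk≈ (S.∣-trans d p)

  ∣⇒≈0 : ∀ {m a} → m ∣ₛ a → a ≈[ m ] + 0
  ∣⇒≈0 {m} {a} p = mk≈ (subst (m ∣ₛ_) (sym (diff-0 a)) p)

  ≈0⇒∣ : ∀ {m a} → a ≈[ m ] + 0 → m ∣ₛ a
  ≈0⇒∣ {m} {a} (mk≈ p) = subst (m ∣ₛ_) (diff-0 a) p

  ∣-resp-≈ : ∀ {m a b} → a ≈[ m ] b → m ∣ₛ b → m ∣ₛ a
  ∣-resp-≈ p q = ≈0⇒∣ (≈-trans p (∣⇒≈0 q))

*-≈-scale : ∀ {d m} a {A B} → d ∣ₛ a → A ≈[ m ] B → a * A ≈[ d * m ] a * B
*-≈-scale {d} {m} a {A} {B} (divides q refl) (mk≈ (divides r e)) = mk≈ (divides (q * r) (begin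
    q * d * A - q * d * B   ≡⟨ factor (q * d) A B ⟩
    q * d * (A - B)         ≡⟨ cong (q * d *_) e ⟩
    q * d * (r * m)         ≡⟨ regroup q d r m ⟩
    q * r * (d * m)         ∎))
  where
  open ≡-Reasoning
  factor : ∀ a A B → a * A - a * B ≡ a * (A - B)
  factor = solve-∀
  regroup : ∀ q d r m → q * d * (r * m) ≡ q * r * (d * m)
  regroup = solve-∀

module _ where
  private
    divmod : ∀ A M .{{_ : NonZero M}} → + A ≡ + (A % M) + + (A / M) * + M
    divmod A M = begin
      + A                                ≡⟨ cong +_ (m≡m%n+[m/n]*n A M) ⟩
      + (A % M ℕ.+ A / M ℕ.* M)          ≡⟨ ℤP.pos-+ (A % M) _ ⟩
      + (A % M) + + (A / M ℕ.* M)        ≡⟨ cong (λ t → + (A % M) + t) (ℤP.pos-* (A / M) M) ⟩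
      + (A % M) + + (A / M) * + M        ∎
      where open ≡-Reasoning
    rearrange : ∀ r q s m → (r + q * m) - (r + s * m) ≡ (q - s) * m
    rearrange = solve-∀
    solveShift : ∀ a b q m → a - b ≡ q * m → a ≡ b + q * m
    solveShift a b q m e = trans (lemma a b) (cong (_+_ b) e)
      where
      lemma : ∀ a b → a ≡ b + (a - b)
      lemma = solve-∀
    shift : ∀ a b q m → a - b ≡ q * m → b ≡ a + (- q) * m
    shift a b q m e = subst (λ a → b ≡ a + (- q) * m) (sym (solveShift a b q m e)) (cancel b q m)
      where
      cancel : ∀ b q m → b ≡ b + q * m + (- q) * m
      cancel = solve-∀
    %-shift : ∀ A B n M .{{_ : NonZero M}} → + A ≡ + B + + n * + M → A % M ≡ B % M
    %-shift A B n M e = trans (cong (_% M) A≡) ([m+kn]%n≡m%n B n M)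
      where
      A≡ : A ≡ B ℕ.+ n ℕ.* M
      A≡ = ℤP.+-injective (trans e (trans (cong (λ t → + B + t) (sym (ℤP.pos-* n M))) (sym (ℤP.pos-+ B (n ℕ.* M)))))

  %≡⇒≈ : ∀ A B M .{{_ : NonZero M}} → A % M ≡ B % M → + A ≈[ + M ] + B
  %≡⇒≈ A B M e = mk≈ (divides (+ (A / M) - + (B / M)) (begin
    + A - + B                                            ≡⟨ cong₂ _-_ (divmod A M) (divmod B M) ⟩
    (+ (A % M) + + (A / M) * + M) - (+ (B % M) + + (B / M) * + M)
      ≡⟨ cong (λ r → (+ (A % M) + + (A / M) * + M) - (r + + (B / M) * + M)) (cong +_ (sym e)) ⟩
    (+ (A % M) + + (A / M) * + M) - (+ (A % M) + + (B / M) * + M)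
      ≡⟨ rearrange (+ (A % M)) (+ (A / M)) (+ (B / M)) (+ M) ⟩
    (+ (A / M) - + (B / M)) * + M                        ∎))
    where open ≡-Reasoning

  ≈⇒%≡ : ∀ A B M .{{_ : NonZero M}} → + A ≈[ + M ] + B → A % M ≡ B % M
  ≈⇒%≡ A B M (mk≈ (divides (+ n) e)) = %-shift A B n M (solveShift (+ A) (+ B) (+ n) (+ M) e)
  ≈⇒%≡ A B M (mk≈ (divides -[1+ n ] e)) =
    sym (%-shift B A (suc n) M (shift (+ A) (+ B) -[1+ n ] (+ M) e))

p3 : ℕ → ℤ
p3 k = + (3 ^ k)

-- (the modulus 3^k is nonzero; passed explicitly since k cannot be inferred from 3 ^ k)
nz3 : ∀ k → NonZero (3 ^ k)
nz3 k = ℕP.m^n≢0 3 k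

p3-+ : ∀ a b → p3 (a ℕ.+ b) ≡ p3 a * p3 b
p3-+ a b = trans (cong +_ (ℕP.^-distribˡ-+-* 3 a b)) (ℤP.pos-* (3 ^ a) (3 ^ b))

p3-suc : ∀ a → p3 (suc a) ≡ + 3 * p3 a
p3-suc a = ℤP.pos-* 3 (3 ^ a)

p3-mono : ∀ {k n} → k ≤ n → p3 k ∣ₛ p3 n
p3-mono {k} {n} k≤n = divides (p3 (n ℕ.∸ k)) (begin
  p3 n                    ≡⟨ cong p3 (sym (ℕP.m∸n+n≡m k≤n)) ⟩
  p3 (n ℕ.∸ k ℕ.+ k)      ≡⟨ p3-+ (n ℕ.∸ k) k ⟩
  p3 (n ℕ.∸ k) * p3 k     ∎)
  where open ≡-Reasoning

p3-suc-∣ : ∀ M x → p3 (suc M) ∣ₛ x * p3 M ⇔ + 3 ∣ₛ x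
p3-suc-∣ M x = mk⇔
  (λ d → S.*-cancelʳ-∣ (p3 M) {{nz3 M}} (subst (λ t → t ∣ₛ x * p3 M) (p3-suc M) d))
  (λ d → subst (λ t → t ∣ₛ x * p3 M) (sym (p3-suc M)) (S.*-monoˡ-∣ (p3 M) d))

red≡⇒≈ : ∀ A B k → red k A ≡ red k B → + A ≈[ p3 k ] + B
red≡⇒≈ A B k = %≡⇒≈ A B (3 ^ k) {{nz3 k}}

≈⇒red≡ : ∀ A B k → + A ≈[ p3 k ] + B → red k A ≡ red k B
≈⇒red≡ A B k = ≈⇒%≡ A B (3 ^ k) {{nz3 k}}

≈red : ∀ X k → + X ≈[ p3 k ] + red k X
≈red X k = red≡⇒≈ X (red k X) k (sym (m%n%n≡m%n X (3 ^ k) {{nz3 k}}))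

red-0 : ∀ k → red k 0 ≡ 0
red-0 k = m*n%n≡0 0 (3 ^ k) {{nz3 k}}

red1≡0⇒3∣ : ∀ A → red 1 A ≡ 0 → + 3 ∣ₛ + A
red1≡0⇒3∣ A e = ≈0⇒∣ (red≡⇒≈ A 0 1 e)

red2≡0⇒9∣ : ∀ A → red 2 A ≡ 0 → + 9 ∣ₛ + A
red2≡0⇒9∣ A e = ≈0⇒∣ (red≡⇒≈ A 0 2 e)

red-red : ∀ {k n} A → k ≤ n → red k (red n A) ≡ red k A
red-red {k} {n} A k≤n = m∣n⇒o%n%m≡o%m (3 ^ k) (3 ^ n) A {{nz3 k}} {{nz3 n}} d
  where
  d : 3 ^ k ℕ∣.∣ 3 ^ n
  d = ℕ∣.divides (3 ^ (n ℕ.∸ k)) (trans (cong (3 ^_) (sym (ℕP.m∸n+n≡m k≤n))) (ℕP.^-distribˡ-+-* 3 (n ℕ.∸ k) k))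

U : ℤ₃ → ℕ → ℤ
U u k = + (seq u k)

seq-reduced : ∀ (u : ℤ₃) k → red k (seq u k) ≡ seq u k
seq-reduced u k = m<n⇒m%n≡m {{nz3 k}} (bounded u k)

seq-0 : ∀ (u : ℤ₃) → seq u 0 ≡ 0
seq-0 u = ℕP.n<1⇒n≡0 (bounded u 0)

seq-coherent : ∀ (u : ℤ₃) {k n} → k ≤ n → red k (seq u n) ≡ seq u k
seq-coherent u {k} {n} k≤n = subst (λ t → red k (seq u t) ≡ seq u k) (ℕP.m∸n+n≡m k≤n) (go (n ℕ.∸ k))
  where
  go : ∀ j → red k (seq u (j ℕ.+ k)) ≡ seq u k
  go zero = seq-reduced u k
  go (suc j) = begin
    red k (seq u (suc j ℕ.+ k))                     ≡⟨ sym (red-red (seq u (suc j ℕ.+ k)) (ℕP.m≤n+m k j)) ⟩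
    red k (red (j ℕ.+ k) (seq u (suc j ℕ.+ k)))     ≡⟨ cong (red k) (coherent u (j ℕ.+ k)) ⟩
    red k (seq u (j ℕ.+ k))                         ≡⟨ go j ⟩
    seq u k                                         ∎
    where open ≡-Reasoning

U-coherent : ∀ (u : ℤ₃) {k n} → k ≤ n → U u n ≈[ p3 k ] U u k
U-coherent u {k} {n} k≤n = red≡⇒≈ (seq u n) (seq u k) k (trans (seq-coherent u k≤n) (sym (seq-reduced u k)))

seq-zero-down : ∀ (u : ℤ₃) {k n} → k ≤ n → seq u n ≡ 0 → seq u k ≡ 0
seq-zero-down u {k} k≤n e = trans (sym (seq-coherent u k≤n)) (trans (cong (red k) e) (red-0 k))

const : ℕ → ℤ₃
const n = record
  { seq = λ k → red k n
  ; bounded = λ k → m%n<n n (3 ^ k) {{nz3 k}}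
  ; coherent = λ k → red-red n (ℕP.n≤1+n k) }

U-const : ∀ n k → U (const n) k ≈[ p3 k ] + n
U-const n k = ≈-sym (≈red n k)

const-nonzero : ∀ {X} → X < 3 → X ≢ 0 → seq (const X) 1 ≢ 0
const-nonzero X<3 X≢0 e = X≢0 (trans (sym (m<n⇒m%n≡m X<3)) e)

HasVal⇒zero : ∀ (u : ℤ₃) {v} → HasVal (seq u) v → ∀ {k} → k ≤ v → seq u k ≡ 0
HasVal⇒zero u {v} h k≤v = seq-zero-down u k≤v (trans (sym (seq-reduced u v)) (proj₁ h))

HasVal⇒nonzero : ∀ (u : ℤ₃) {v} → HasVal (seq u) v → ∀ {k} → v < k → seq u k ≢ 0
HasVal⇒nonzero u {v} h v<k e = proj₂ h (trans (seq-reduced u (suc v)) (seq-zero-down u v<k e))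

unit-mod3 : ∀ (u : ℤ₃) → HasVal (seq u) 0 → seq u 1 ≢ 0
unit-mod3 u h = HasVal⇒nonzero u h ℕP.≤-refl

unit-mod9 : ∀ (u : ℤ₃) → HasVal (seq u) 0 → red 1 (seq u 2) ≢ 0
unit-mod9 u h e = unit-mod3 u h (trans (sym (seq-coherent u (ℕP.n≤1+n 1))) e)

seq-div3 : ∀ (u : ℤ₃) k → seq u 1 ≡ 0 → red 1 (seq u k) ≡ 0
seq-div3 u zero e = cong (red 1) (seq-0 u)
seq-div3 u (suc k) e = trans (seq-coherent u (s≤s z≤n)) e

val-≤-prod : ∀ u1 u2 u3 {v3 w} → HasVal (seq u3) v3 → HasVal (prod3 u1 u2 u3) w → v3 ≤ w
val-≤-prod u1 u2 u3 {v3} {w} h3 hw with v3 ℕP.≤? w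
... | yes v3≤w = v3≤w
... | no v3≰w = ⊥-elim (proj₂ hw (trans (cong (red (suc w)) prod≡0) (red-0 (suc w))))
  where
  a b : ℕ
  a = seq u1 (suc w)
  b = seq u2 (suc w)
  prod≡0 : prod3 u1 u2 u3 (suc w) ≡ 0
  prod≡0 = begin
    red (suc w) (a ℕ.* (b ℕ.* seq u3 (suc w)))  ≡⟨ cong (λ t → red (suc w) (a ℕ.* (b ℕ.* t))) (HasVal⇒zero u3 h3 (ℕP.≰⇒> v3≰w)) ⟩
    red (suc w) (a ℕ.* (b ℕ.* 0))               ≡⟨ cong (λ t → red (suc w) (a ℕ.* t)) (ℕP.*-zeroʳ b) ⟩
    red (suc w) (a ℕ.* 0)                       ≡⟨ cong (red (suc w)) (ℕP.*-zeroʳ a) ⟩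
    red (suc w) 0                               ≡⟨ red-0 (suc w) ⟩
    0                                           ∎
    where open ≡-Reasoning

-- The cubic form  E = a1 x³ + a2 y³ + a3 z³ - c x y z  over ℤ.
-- (cube x is written so that it agrees with the unfolding of ℕ's x ^ 3.)
cube : ℤ → ℤ
cube x = x * (x * (x * + 1))

E : (a1 a2 a3 c x y z : ℤ) → ℤ
E a1 a2 a3 c x y z = (a1 * cube x + a2 * cube y + a3 * cube z) - c * (x * (y * z))

cube-cong : ∀ {m x x'} → x ≈[ m ] x' → cube x ≈[ m ] cube x'
cube-cong p = ≈-* p (≈-* p (≈-* p (≈-refl _)))

E-cong : ∀ {m a1 a2 a3 c x y z a1' a2' a3' c' x' y' z'} →
  a1 ≈[ m ] a1' → a2 ≈[ m ] a2' → a3 ≈[ m ] a3' → c ≈[ m ] c' →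
  x ≈[ m ] x' → y ≈[ m ] y' → z ≈[ m ] z' →
  E a1 a2 a3 c x y z ≈[ m ] E a1' a2' a3' c' x' y' z'
E-cong p1 p2 p3 pc px py pz =
  ≈-- (≈-+ (≈-+ (≈-* p1 (cube-cong px)) (≈-* p2 (cube-cong py))) (≈-* p3 (cube-cong pz)))
      (≈-* pc (≈-* px (≈-* py pz)))

E-at : (u1 u2 u3 c x y z : ℤ₃) → ℕ → ℤ
E-at u1 u2 u3 c x y z k = E (U u1 k) (U u2 k) (U u3 k) (U c k) (U x k) (U y k) (U z k)

module _ where
  private
    cube-pos : ∀ x → + (x ^ 3) ≡ cube (+ x)
    cube-pos x = trans (ℤP.pos-* x (x ^ 2))
      (cong (+ x *_) (trans (ℤP.pos-* x (x ^ 1)) (cong (+ x *_) (ℤP.pos-* x 1))))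
    monomial-pos : ∀ a x → + (a ℕ.* x ^ 3) ≡ + a * cube (+ x)
    monomial-pos a x = trans (ℤP.pos-* a (x ^ 3)) (cong (+ a *_) (cube-pos x))
    cubes-pos : ∀ a b c x y z →
      + (a ℕ.* x ^ 3 ℕ.+ b ℕ.* y ^ 3 ℕ.+ c ℕ.* z ^ 3) ≡ + a * cube (+ x) + + b * cube (+ y) + + c * cube (+ z)
    cubes-pos a b c x y z = trans (ℤP.pos-+ (a ℕ.* x ^ 3 ℕ.+ b ℕ.* y ^ 3) (c ℕ.* z ^ 3))
      (cong₂ _+_ (trans (ℤP.pos-+ (a ℕ.* x ^ 3) (b ℕ.* y ^ 3)) (cong₂ _+_ (monomial-pos a x) (monomial-pos b y)))
                 (monomial-pos c z))
    product-pos : ∀ c x y z → + (c ℕ.* (x ℕ.* (y ℕ.* z))) ≡ + c * (+ x * (+ y * + z))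
    product-pos c x y z = trans (ℤP.pos-* c (x ℕ.* (y ℕ.* z)))
      (cong (+ c *_) (trans (ℤP.pos-* x (y ℕ.* z)) (cong (+ x *_) (ℤP.pos-* y z))))
    diff≈0 : ∀ {m a b} → a ≈[ m ] b → a - b ≈[ m ] + 0
    diff≈0 p = ∣⇒≈0 (un≈ p)

  Solves⇔E≈0 : ∀ u1 u2 u3 c x y z →
    Solves u1 u2 u3 c x y z ⇔ (∀ k → E-at u1 u2 u3 c x y z k ≈[ p3 k ] + 0)
  Solves⇔E≈0 u1 u2 u3 c x y z = mk⇔
    (λ s k → diff≈0 (subst₂ (λ l r → l ≈[ p3 k ] r) (lhs k) (rhs k) (red≡⇒≈ _ _ k (s k))))
    (λ h k → ≈⇒red≡ _ _ k (subst₂ (λ l r → l ≈[ p3 k ] r) (sym (lhs k)) (sym (rhs k)) (mk≈ (≈0⇒∣ (h k)))))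
    where
    lhs : ∀ k → + (seq u1 k ℕ.* seq x k ^ 3 ℕ.+ seq u2 k ℕ.* seq y k ^ 3 ℕ.+ seq u3 k ℕ.* seq z k ^ 3)
                ≡ U u1 k * cube (U x k) + U u2 k * cube (U y k) + U u3 k * cube (U z k)
    lhs = λ k → cubes-pos (seq u1 k) (seq u2 k) (seq u3 k) (seq x k) (seq y k) (seq z k)
    rhs : ∀ k → + (seq c k ℕ.* (seq x k ℕ.* (seq y k ℕ.* seq z k))) ≡ U c k * (U x k * (U y k * U z k))
    rhs = λ k → product-pos (seq c k) (seq x k) (seq y k) (seq z k)

module _ where
  private
    E-swap₁₂ : ∀ a1 a2 a3 c x y z → E a1 a2 a3 c x y z ≡ E a2 a1 a3 c y x z
    E-swap₁₂ = identity
      where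
      identity : ∀ a1 a2 a3 c x y z →
        (a1 * (x * (x * (x * + 1))) + a2 * (y * (y * (y * + 1))) + a3 * (z * (z * (z * + 1)))) - c * (x * (y * z))
        ≡ (a2 * (y * (y * (y * + 1))) + a1 * (x * (x * (x * + 1))) + a3 * (z * (z * (z * + 1)))) - c * (y * (x * z))
      identity = solve-∀
    E-swap₂₃ : ∀ a1 a2 a3 c x y z → E a1 a2 a3 c x y z ≡ E a1 a3 a2 c x z y
    E-swap₂₃ = identity
      where
      identity : ∀ a1 a2 a3 c x y z →
        (a1 * (x * (x * (x * + 1))) + a2 * (y * (y * (y * + 1))) + a3 * (z * (z * (z * + 1)))) - c * (x * (y * z))
        ≡ (a1 * (x * (x * (x * + 1))) + a3 * (z * (z * (z * + 1))) + a2 * (y * (y * (y * + 1)))) - c * (x * (z * y))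
      identity = solve-∀
    transport : ∀ u1 u2 u3 x y z v1 v2 v3 x' y' z' c →
      (∀ k → E-at u1 u2 u3 c x y z k ≡ E-at v1 v2 v3 c x' y' z' k) →
      Solves v1 v2 v3 c x' y' z' → Solves u1 u2 u3 c x y z
    transport u1 u2 u3 x y z v1 v2 v3 x' y' z' c e s =
      Equivalence.from (Solves⇔E≈0 u1 u2 u3 c x y z)
        (λ k → subst (λ t → t ≈[ p3 k ] + 0) (sym (e k)) (Equivalence.to (Solves⇔E≈0 v1 v2 v3 c x' y' z') s k))

  Soluble-swap₁₂ : ∀ u1 u2 u3 c → Soluble u2 u1 u3 c → Soluble u1 u2 u3 c
  Soluble-swap₁₂ u1 u2 u3 c (y , x , z , (k , nz) , s) =
    x , y , z , (k , swap nz) , transport u1 u2 u3 x y z u2 u1 u3 y x z c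
      (λ k → E-swap₁₂ (U u1 k) (U u2 k) (U u3 k) (U c k) (U x k) (U y k) (U z k)) s
    where
    swap : ∀ {P Q R : Set} → P ⊎ Q ⊎ R → Q ⊎ P ⊎ R
    swap (inj₁ p) = inj₂ (inj₁ p)
    swap (inj₂ (inj₁ q)) = inj₁ q
    swap (inj₂ (inj₂ r)) = inj₂ (inj₂ r)

  Soluble-swap₂₃ : ∀ u1 u2 u3 c → Soluble u1 u3 u2 c → Soluble u1 u2 u3 c
  Soluble-swap₂₃ u1 u2 u3 c (x , z , y , (k , nz) , s) =
    x , y , z , (k , swap nz) , transport u1 u2 u3 x y z u1 u3 u2 x z y c
      (λ k → E-swap₂₃ (U u1 k) (U u2 k) (U u3 k) (U c k) (U x k) (U y k) (U z k)) s
    where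
    swap : ∀ {P Q R : Set} → P ⊎ Q ⊎ R → P ⊎ R ⊎ Q
    swap (inj₁ p) = inj₁ p
    swap (inj₂ (inj₁ q)) = inj₂ (inj₂ q)
    swap (inj₂ (inj₂ r)) = inj₂ (inj₁ r)

  Soluble-swap₁₃ : ∀ u1 u2 u3 c → Soluble u3 u2 u1 c → Soluble u1 u2 u3 c
  Soluble-swap₁₃ u1 u2 u3 c s =
    Soluble-swap₁₂ u1 u2 u3 c (Soluble-swap₂₃ u2 u1 u3 c (Soluble-swap₁₂ u2 u3 u1 c s))

ExactVal : ℕ → ℤ → Set
ExactVal e x = (p3 e ∣ₛ x) × ¬ (p3 (suc e) ∣ₛ x)

ExactVal-resp-≈ : ∀ {e x y} → x ≈[ p3 (suc e) ] y → ExactVal e y → ExactVal e x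
ExactVal-resp-≈ {e} x≈y (e∣y , ¬e+1∣y) =
  ∣-resp-≈ (≈-weaken (p3-mono (ℕP.n≤1+n e)) x≈y) e∣y , λ e+1∣x → ¬e+1∣y (∣-resp-≈ (≈-sym x≈y) e+1∣x)

ExactVal-scale : ∀ e k d Δ → (d ≡ 1 ⊎ d ≡ 2) → ExactVal e Δ → ExactVal (k ℕ.+ e) (+ (d ℕ.* 3 ^ k) * Δ)
ExactVal-scale e k d Δ d∈12 (divides δ refl , ¬e+1∣Δ) =
  subst (p3 (k ℕ.+ e) ∣ₛ_) (sym product) (divides (+ d * δ) refl) ,
  λ h → ¬e+1∣Δ (Equivalence.from (p3-suc-∣ e δ)
          (unit-factor d∈12 (Equivalence.to (p3-suc-∣ (k ℕ.+ e) (+ d * δ)) (subst (p3 (suc (k ℕ.+ e)) ∣ₛ_) product h))))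
  where
  product : + (d ℕ.* 3 ^ k) * (δ * p3 e) ≡ + d * δ * p3 (k ℕ.+ e)
  product = begin
    + (d ℕ.* 3 ^ k) * (δ * p3 e)   ≡⟨ cong (_* (δ * p3 e)) (ℤP.pos-* d (3 ^ k)) ⟩
    + d * p3 k * (δ * p3 e)        ≡⟨ regroup (+ d) (p3 k) δ (p3 e) ⟩
    + d * δ * (p3 k * p3 e)        ≡⟨ cong (+ d * δ *_) (sym (p3-+ k e)) ⟩
    + d * δ * p3 (k ℕ.+ e)         ∎
    where
    open ≡-Reasoning
    regroup : ∀ a b c d → a * b * (c * d) ≡ a * c * (b * d)
    regroup = solve-∀
  unit-factor : ∀ {d} → (d ≡ 1 ⊎ d ≡ 2) → + 3 ∣ₛ + d * δ → + 3 ∣ₛ δ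
  unit-factor (inj₁ refl) 3∣δ = subst (+ 3 ∣ₛ_) (ℤP.*-identityˡ δ) 3∣δ
  unit-factor (inj₂ refl) 3∣2δ =
    subst (+ 3 ∣ₛ_) (four-minus-three δ) (S.∣m∣n⇒∣m-n (S.∣m⇒∣m*n (+ 2) 3∣2δ) (S.∣n⇒∣m*n δ (S.∣-refl {+ 3})))
    where
    four-minus-three : ∀ δ → + 2 * δ * + 2 - δ * + 3 ≡ δ
    four-minus-three = solve-∀

mod3-pigeonhole : ∀ q0 q1 q2 → ¬ (+ 3 ∣ₛ q1 - q0) → ¬ (+ 3 ∣ₛ q2 - q0) → ¬ (+ 3 ∣ₛ q2 - q1) →
  (+ 3 ∣ₛ q0) ⊎ (+ 3 ∣ₛ q1) ⊎ (+ 3 ∣ₛ q2)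
mod3-pigeonhole q0 q1 q2 n10 n20 n21 = go (residue q0) (residue q1) (residue q2)
  where
  data Residue (q : ℤ) : Set where
    r0 : q ≈[ + 3 ] + 0 → Residue q
    r1 : q ≈[ + 3 ] + 1 → Residue q
    r2 : q ≈[ + 3 ] + 2 → Residue q
  residue : ∀ q → Residue q
  residue q with q ℤD.%ℕ 3 | ℤD.n%ℕd<d q 3 | ℤD.a≡a%ℕn+[a/ℕn]*n q 3
  ... | 0 | _ | eq = r0 (represent eq)
    where represent : q ≡ + 0 + (q ℤD./ℕ 3) * + 3 → q ≈[ + 3 ] + 0
          represent eq = mk≈ (divides (q ℤD./ℕ 3) (trans (ℤP.+-identityʳ q) (trans eq (ℤP.+-identityˡ _))))
  ... | 1 | _ | eq = r1 (mk≈ (divides (q ℤD./ℕ 3) (trans (cong (_- + 1) eq) (cancel (q ℤD./ℕ 3)))))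
    where cancel : ∀ s → + 1 + s * + 3 - + 1 ≡ s * + 3
          cancel = solve-∀
  ... | 2 | _ | eq = r2 (mk≈ (divides (q ℤD./ℕ 3) (trans (cong (_- + 2) eq) (cancel (q ℤD./ℕ 3)))))
    where cancel : ∀ s → + 2 + s * + 3 - + 2 ≡ s * + 3
          cancel = solve-∀
  ... | suc (suc (suc _)) | s≤s (s≤s (s≤s ())) | _
  same : ∀ {a b r} → a ≈[ + 3 ] r → b ≈[ + 3 ] r → + 3 ∣ₛ b - a
  same pa pb = un≈ (≈-trans pb (≈-sym pa))
  go : Residue q0 → Residue q1 → Residue q2 → (+ 3 ∣ₛ q0) ⊎ (+ 3 ∣ₛ q1) ⊎ (+ 3 ∣ₛ q2)
  go (r0 p) _ _ = inj₁ (≈0⇒∣ p)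
  go _ (r0 p) _ = inj₂ (inj₁ (≈0⇒∣ p))
  go _ _ (r0 p) = inj₂ (inj₂ (≈0⇒∣ p))
  go (r1 p) (r1 q) _ = ⊥-elim (n10 (same p q))
  go (r2 p) (r2 q) _ = ⊥-elim (n10 (same p q))
  go (r1 p) _ (r1 q) = ⊥-elim (n20 (same p q))
  go (r2 p) _ (r2 q) = ⊥-elim (n20 (same p q))
  go _ (r1 p) (r1 q) = ⊥-elim (n21 (same p q))
  go _ (r2 p) (r2 q) = ⊥-elim (n21 (same p q))

scaled-pigeonhole : ∀ M V0 V1 V2 → p3 M ∣ₛ V0 →
  ExactVal M (V1 - V0) → ExactVal M (V2 - V0) → ExactVal M (V2 - V1) →
  (p3 (suc M) ∣ₛ V0) ⊎ (p3 (suc M) ∣ₛ V1) ⊎ (p3 (suc M) ∣ₛ V2)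
scaled-pigeonhole M V0 V1 V2 M∣V0 (M∣D1 , ¬D1) (M∣D2 , ¬D2) (_ , ¬D21) =
  go M∣V0 (subst (p3 M ∣ₛ_) (restore V1 V0) (S.∣m∣n⇒∣m+n M∣D1 M∣V0))
          (subst (p3 M ∣ₛ_) (restore V2 V0) (S.∣m∣n⇒∣m+n M∣D2 M∣V0))
  where
  restore : ∀ a b → a - b + b ≡ a
  restore = solve-∀
  factor : ∀ a b m → a * m - b * m ≡ (a - b) * m
  factor = solve-∀
  lift : ∀ x → + 3 ∣ₛ x → p3 (suc M) ∣ₛ x * p3 M
  lift x = Equivalence.from (p3-suc-∣ M x)
  go : p3 M ∣ₛ V0 → p3 M ∣ₛ V1 → p3 M ∣ₛ V2 → (p3 (suc M) ∣ₛ V0) ⊎ (p3 (suc M) ∣ₛ V1) ⊎ (p3 (suc M) ∣ₛ V2)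
  go (divides q0 refl) (divides q1 refl) (divides q2 refl)
    with mod3-pigeonhole q0 q1 q2
           (λ d → ¬D1 (subst (p3 (suc M) ∣ₛ_) (sym (factor q1 q0 (p3 M))) (lift _ d)))
           (λ d → ¬D2 (subst (p3 (suc M) ∣ₛ_) (sym (factor q2 q0 (p3 M))) (lift _ d)))
           (λ d → ¬D21 (subst (p3 (suc M) ∣ₛ_) (sym (factor q2 q1 (p3 M))) (lift _ d)))
  ... | inj₁ d = inj₁ (lift q0 d)
  ... | inj₂ (inj₁ d) = inj₂ (inj₁ (lift q1 d))
  ... | inj₂ (inj₂ d) = inj₂ (inj₂ (lift q2 d))

-- Hensel lifting for a coherent family of integer functions g N ("the equation modulo 3^N").
module HenselLifting
  (g : ℕ → ℤ → ℤ) (e t0 : ℕ)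
  (g-coherent : ∀ {N N'} → N ≤ N' → ∀ t → g N' t ≈[ p3 N ] g N t)
  (g-cong : ∀ N {m t t'} → t ≈[ m ] t' → g N t ≈[ m ] g N t')
  (g-slope : ∀ N r k d → suc e ≤ N → + r ≈[ + 3 ] + t0 → (d ≡ 1 ⊎ d ≡ 2) →
               ExactVal (suc k ℕ.+ e) (g N (+ (r ℕ.+ d ℕ.* 3 ^ suc k)) - g N (+ r)))
  (g-root : g (suc e) (+ t0) ≈[ p3 (suc e) ] + 0)
  where

  Approx : ℕ → ℕ → Set
  Approx n r = (+ r ≈[ + 3 ] + t0) × (g (suc (n ℕ.+ e)) (+ r) ≈[ p3 (suc (n ℕ.+ e)) ] + 0)

  correction-≈ : ∀ r j n → + (r ℕ.+ j ℕ.* 3 ^ suc n) ≈[ + 3 ] + r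
  correction-≈ r j n = red≡⇒≈ _ _ 1 (trans (cong (λ t → (r ℕ.+ t) % 3) multiple) ([m+kn]%n≡m%n r (j ℕ.* 3 ^ n) 3))
    where
    multiple : j ℕ.* 3 ^ suc n ≡ j ℕ.* 3 ^ n ℕ.* 3
    multiple = trans (cong (j ℕ.*_) (ℕP.*-comm 3 (3 ^ n))) (sym (ℕP.*-assoc j (3 ^ n) 3))

  lift-step : ∀ n r → Approx n r → Σ ℕ λ j → Approx (suc n) (r ℕ.+ j ℕ.* 3 ^ suc n)
  lift-step n r (r≈t0 , root) = choose (scaled-pigeonhole M V0 V1 V2 M∣V0 D10 D20 D21)
    where
    M P : ℕ
    M = suc (n ℕ.+ e)
    P = 3 ^ suc n
    e+1≤M+1 : suc e ≤ suc M
    e+1≤M+1 = s≤s (ℕP.m≤n⇒m≤1+n (ℕP.m≤n+m e n))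
    r+P≈t0 : + (r ℕ.+ 1 ℕ.* P) ≈[ + 3 ] + t0
    r+P≈t0 = ≈-trans (correction-≈ r 1 n) r≈t0
    V0 V1 V2 : ℤ
    V0 = g (suc M) (+ r)
    V1 = g (suc M) (+ (r ℕ.+ 1 ℕ.* P))
    V2 = g (suc M) (+ (r ℕ.+ 2 ℕ.* P))
    M∣V0 : p3 M ∣ₛ V0
    M∣V0 = ≈0⇒∣ (≈-trans (g-coherent (ℕP.n≤1+n M) (+ r)) root)
    D10 : ExactVal M (V1 - V0)
    D10 = g-slope (suc M) r n 1 e+1≤M+1 r≈t0 (inj₁ refl)
    D20 : ExactVal M (V2 - V0)
    D20 = g-slope (suc M) r n 2 e+1≤M+1 r≈t0 (inj₂ refl)
    D21 : ExactVal M (V2 - V1)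
    D21 = subst (λ s → ExactVal M (g (suc M) (+ s) - V1)) two-steps
            (g-slope (suc M) (r ℕ.+ 1 ℕ.* P) n 1 e+1≤M+1 r+P≈t0 (inj₁ refl))
      where
      two-steps : r ℕ.+ 1 ℕ.* P ℕ.+ 1 ℕ.* P ≡ r ℕ.+ 2 ℕ.* P
      two-steps = trans (ℕP.+-assoc r (1 ℕ.* P) (1 ℕ.* P)) (cong (λ t → r ℕ.+ (t ℕ.+ 1 ℕ.* P)) (ℕP.+-identityʳ P))
    choose : (p3 (suc M) ∣ₛ V0) ⊎ (p3 (suc M) ∣ₛ V1) ⊎ (p3 (suc M) ∣ₛ V2) →
             Σ ℕ λ j → Approx (suc n) (r ℕ.+ j ℕ.* P)
    choose (inj₁ d) = 0 , subst (Approx (suc n)) (sym (ℕP.+-identityʳ r)) (r≈t0 , ∣⇒≈0 d)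
    choose (inj₂ (inj₁ d)) = 1 , r+P≈t0 , ∣⇒≈0 d
    choose (inj₂ (inj₂ d)) = 2 , ≈-trans (correction-≈ r 2 n) r≈t0 , ∣⇒≈0 d

  approx : ∀ n → Σ ℕ (Approx n)
  approx zero = t0 , ≈-refl _ , g-root
  approx (suc n) with approx n
  ... | r , a = r ℕ.+ proj₁ (lift-step n r a) ℕ.* 3 ^ suc n , proj₂ (lift-step n r a)

  approx-correction : ∀ n → Σ ℕ λ j → proj₁ (approx (suc n)) ≡ proj₁ (approx n) ℕ.+ j ℕ.* 3 ^ suc n
  approx-correction n with approx n
  ... | r , a = proj₁ (lift-step n r a) , refl

  limit : ℤ₃
  limit = record
    { seq = λ k → red k (proj₁ (approx k))
    ; bounded = λ k → m%n<n (proj₁ (approx k)) (3 ^ k) {{nz3 k}}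
    ; coherent = λ k → levels-agree k (approx-correction k) }
    where
    levels-agree : ∀ k → (Σ ℕ λ j → proj₁ (approx (suc k)) ≡ proj₁ (approx k) ℕ.+ j ℕ.* 3 ^ suc k) →
               red k (red (suc k) (proj₁ (approx (suc k)))) ≡ red k (proj₁ (approx k))
    levels-agree k (j , eq) = begin
      red k (red (suc k) (proj₁ (approx (suc k))))    ≡⟨ red-red _ (ℕP.n≤1+n k) ⟩
      red k (proj₁ (approx (suc k)))                  ≡⟨ cong (red k) eq ⟩
      red k (proj₁ (approx k) ℕ.+ j ℕ.* 3 ^ suc k)     ≡⟨ cong (λ t → red k (proj₁ (approx k) ℕ.+ t)) (sym (ℕP.*-assoc j 3 (3 ^ k))) ⟩
      red k (proj₁ (approx k) ℕ.+ j ℕ.* 3 ℕ.* 3 ^ k)   ≡⟨ [m+kn]%n≡m%n (proj₁ (approx k)) (j ℕ.* 3) (3 ^ k) {{nz3 k}} ⟩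
      red k (proj₁ (approx k))                        ∎
      where open ≡-Reasoning

  limit-is-root : ∀ k → g k (U limit k) ≈[ p3 k ] + 0
  limit-is-root k =
    ≈-trans (g-cong k (≈-sym (≈red r k)))
      (≈-trans (≈-sym (g-coherent k≤ (+ r))) (≈-weaken (p3-mono k≤) (proj₂ (proj₂ (approx k)))))
    where
    r : ℕ
    r = proj₁ (approx k)
    k≤ : k ≤ suc (k ℕ.+ e)
    k≤ = ℕP.m≤n⇒m≤1+n (ℕP.m≤m+n k e)

-- A simple root of the cubic modulo 3^(e+1), to be lifted in the third variable:
-- (X, Y, t) with X or Y a nonzero residue mod 3, a root modulo 3^(e+1), such that the
-- partial derivative  3 u3 t² - c X Y  has valuation exactly e, and 3^(e+1) ∣ 9 u3
-- (which makes the higher-order terms of the Taylor expansion negligible).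
record SimpleRoot (e : ℕ) (u1 u2 u3 c : ℤ₃) : Set where
  field
    X Y t : ℕ
    nontrivial : (X < 3 × X ≢ 0) ⊎ (Y < 3 × Y ≢ 0)
    root : p3 (suc e) ∣ₛ E (U u1 (suc e)) (U u2 (suc e)) (U u3 (suc e)) (U c (suc e)) (+ X) (+ Y) (+ t)
    small-u3 : p3 (suc e) ∣ₛ + 9 * U u3 (suc e)
    slope : ExactVal e (+ 3 * U u3 (suc e) * (+ t * + t) - U c (suc e) * (+ X * + Y))

module ThirdVariable (u1 u2 u3 c : ℤ₃) (X Y : ℕ) where
  private
    E-difference : ∀ a1 a2 a3 c x y r h →
      E a1 a2 a3 c x y (r + h) - E a1 a2 a3 c x y r ≡ h * (a3 * (+ 3 * (r * r) + + 3 * r * h + h * h) - c * (x * y))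
    E-difference = identity
      where
      identity : ∀ a1 a2 a3 c x y r h →
        ((a1 * (x * (x * (x * + 1))) + a2 * (y * (y * (y * + 1))) + a3 * ((r + h) * ((r + h) * ((r + h) * + 1))))
          - c * (x * (y * (r + h))))
        - ((a1 * (x * (x * (x * + 1))) + a2 * (y * (y * (y * + 1))) + a3 * (r * (r * (r * + 1)))) - c * (x * (y * r)))
        ≡ h * (a3 * (+ 3 * (r * r) + + 3 * r * h + h * h) - c * (x * y))
      identity = solve-∀
    quotient-vs-derivative : ∀ aN aL cN cL t w s x y →
      (aN * (+ 3 * ((t + w * + 3) * (t + w * + 3)) + + 3 * (t + w * + 3) * (+ 3 * s) + (+ 3 * s) * (+ 3 * s))
        - cN * (x * y))
      - (+ 3 * aL * (t * t) - cL * (x * y))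
      ≡ (+ 9 * aN) * ((t + w * + 3) * s + s * s + + 2 * t * w + + 3 * w * w)
        + + 3 * (aN - aL) * (t * t) - (cN - cL) * (x * y)
    quotient-vs-derivative = solve-∀
    from-difference : ∀ r t w → r - t ≡ w * + 3 → r ≡ t + w * + 3
    from-difference r t w e = trans (identity r t) (cong (_+_ t) e)
      where
      identity : ∀ r t → r ≡ t + (r - t)
      identity = solve-∀
    triple : ∀ d k → + (d ℕ.* 3 ^ suc k) ≡ + 3 * + (d ℕ.* 3 ^ k)
    triple d k = trans (cong +_ (trans (cong (d ℕ.*_) (ℕP.*-comm 3 (3 ^ k)))
                   (trans (sym (ℕP.*-assoc d (3 ^ k) 3)) (ℕP.*-comm (d ℕ.* 3 ^ k) 3))))
                 (ℤP.pos-* 3 (d ℕ.* 3 ^ k))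

  g : ℕ → ℤ → ℤ
  g N t = E (U u1 N) (U u2 N) (U u3 N) (U c N) (+ X) (+ Y) t

  g-coherent : ∀ {N N'} → N ≤ N' → ∀ t → g N' t ≈[ p3 N ] g N t
  g-coherent N≤N' t = E-cong (U-coherent u1 N≤N') (U-coherent u2 N≤N') (U-coherent u3 N≤N') (U-coherent c N≤N')
                             (≈-refl (+ X)) (≈-refl (+ Y)) (≈-refl t)

  g-cong : ∀ N {m t t'} → t ≈[ m ] t' → g N t ≈[ m ] g N t'
  g-cong N = E-cong (≈-refl (U u1 N)) (≈-refl (U u2 N)) (≈-refl (U u3 N)) (≈-refl (U c N)) (≈-refl (+ X)) (≈-refl (+ Y))

  derivative : ℕ → ℤ → ℤ
  derivative L t = + 3 * U u3 L * (t * t) - U c L * (+ X * + Y)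

  quotient : ℕ → ℤ → ℤ → ℤ
  quotient N r h = U u3 N * (+ 3 * (r * r) + + 3 * r * h + h * h) - U c N * (+ X * + Y)

  g-difference : ∀ N r h → g N (+ (r ℕ.+ h)) - g N (+ r) ≡ + h * quotient N (+ r) (+ h)
  g-difference N r h = trans (cong (λ s → g N s - g N (+ r)) (ℤP.pos-+ r h))
                             (E-difference (U u1 N) (U u2 N) (U u3 N) (U c N) (+ X) (+ Y) (+ r) (+ h))

  -- Near t, for steps divisible by 3, the difference quotient is the derivative modulo 3^L,
  -- provided 3^L ∣ 9 u3 (the quadratic and cubic Taylor terms then vanish).
  quotient≈derivative : ∀ {L} N r t s → L ≤ N → p3 L ∣ₛ + 9 * U u3 L → + r ≈[ + 3 ] + t →
    quotient N (+ r) (+ 3 * s) ≈[ p3 L ] derivative L (+ t)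
  quotient≈derivative {L} N r t s L≤N small-u3 (mk≈ (divides w r-t≡)) = mk≈ (subst (p3 L ∣ₛ_) (sym expand) divisible)
    where
    expand : quotient N (+ r) (+ 3 * s) - derivative L (+ t)
             ≡ (+ 9 * U u3 N) * ((+ t + w * + 3) * s + s * s + + 2 * + t * w + + 3 * w * w)
               + + 3 * (U u3 N - U u3 L) * (+ t * + t) - (U c N - U c L) * (+ X * + Y)
    expand = trans (cong (λ r → quotient N r (+ 3 * s) - derivative L (+ t)) (from-difference (+ r) (+ t) w r-t≡))
                   (quotient-vs-derivative (U u3 N) (U u3 L) (U c N) (U c L) (+ t) w s (+ X) (+ Y))
    9u3 : p3 L ∣ₛ + 9 * U u3 N
    9u3 = ∣-resp-≈ (≈-* (≈-refl (+ 9)) (U-coherent u3 L≤N)) small-u3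
    divisible : p3 L ∣ₛ (+ 9 * U u3 N) * ((+ t + w * + 3) * s + s * s + + 2 * + t * w + + 3 * w * w)
                        + + 3 * (U u3 N - U u3 L) * (+ t * + t) - (U c N - U c L) * (+ X * + Y)
    divisible = S.∣m∣n⇒∣m-n
      (S.∣m∣n⇒∣m+n (S.∣m⇒∣m*n _ 9u3) (S.∣m⇒∣m*n (+ t * + t) (S.∣n⇒∣m*n (+ 3) (un≈ (U-coherent u3 L≤N)))))
      (S.∣m⇒∣m*n (+ X * + Y) (un≈ (U-coherent c L≤N)))

  g-slope : ∀ e t → p3 (suc e) ∣ₛ + 9 * U u3 (suc e) → ExactVal e (derivative (suc e) (+ t)) →
    ∀ N r k d → suc e ≤ N → + r ≈[ + 3 ] + t → (d ≡ 1 ⊎ d ≡ 2) →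
    ExactVal (suc k ℕ.+ e) (g N (+ (r ℕ.+ d ℕ.* 3 ^ suc k)) - g N (+ r))
  g-slope e t small-u3 slope N r k d L≤N r≈t d∈12 =
    subst (ExactVal (suc k ℕ.+ e)) (sym (g-difference N r (d ℕ.* 3 ^ suc k)))
      (ExactVal-scale e (suc k) d (quotient N (+ r) h) d∈12
        (ExactVal-resp-≈ {e} (subst (λ h → quotient N (+ r) h ≈[ p3 (suc e) ] derivative (suc e) (+ t)) (sym (triple d k))
                                    (quotient≈derivative N r t (+ (d ℕ.* 3 ^ k)) L≤N small-u3 r≈t))
                             slope))
    where
    h : ℤ
    h = + (d ℕ.* 3 ^ suc k)

SimpleRoot⇒Soluble : ∀ e u1 u2 u3 c → SimpleRoot e u1 u2 u3 c → Soluble u1 u2 u3 c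
SimpleRoot⇒Soluble e u1 u2 u3 c sr =
  const X , const Y , limit , (1 , nonzero nontrivial) ,
  Equivalence.from (Solves⇔E≈0 u1 u2 u3 c (const X) (const Y) limit)
    (λ k → ≈-trans (E-cong (≈-refl (U u1 k)) (≈-refl (U u2 k)) (≈-refl (U u3 k)) (≈-refl (U c k))
                           (U-const X k) (U-const Y k) (≈-refl (U limit k)))
                   (limit-is-root k))
  where
  open SimpleRoot sr
  open ThirdVariable u1 u2 u3 c X Y
  open HenselLifting g e t g-coherent g-cong (g-slope e t small-u3 slope) (∣⇒≈0 root)
  nonzero : ∀ {R : Set} → (X < 3 × X ≢ 0) ⊎ (Y < 3 × Y ≢ 0) → (seq (const X) 1 ≢ 0) ⊎ (seq (const Y) 1 ≢ 0) ⊎ R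
  nonzero (inj₁ (X<3 , X≢0)) = inj₁ (const-nonzero X<3 X≢0)
  nonzero (inj₂ (Y<3 , Y≢0)) = inj₂ (inj₁ (const-nonzero Y<3 Y≢0))

-- A primitive solution modulo 27: residues X, Y, Z, not all divisible by 3, solving the cubic
-- modulo 27.  Every nontrivial 3-adic solution yields one, after dividing by the largest
-- common power of 3; all necessary conditions are read off from it.
PrimitiveSolution : (u1 u2 u3 c : ℤ₃) → Set
PrimitiveSolution u1 u2 u3 c = Σ ℕ λ X → Σ ℕ λ Y → Σ ℕ λ Z →
  ((red 1 X ≢ 0) ⊎ (red 1 Y ≢ 0) ⊎ (red 1 Z ≢ 0)) ×
  (p3 3 ∣ₛ E (U u1 3) (U u2 3) (U u3 3) (U c 3) (+ X) (+ Y) (+ Z))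

NonzeroAt : ℤ₃ → ℤ₃ → ℤ₃ → ℕ → Set
NonzeroAt x y z k = (seq x k ≢ 0) ⊎ (seq y k ≢ 0) ⊎ (seq z k ≢ 0)

common-valuation : ∀ x y z k → NonzeroAt x y z k →
  Σ ℕ λ m → (seq x m ≡ 0 × seq y m ≡ 0 × seq z m ≡ 0) × NonzeroAt x y z (suc m)
common-valuation x y z zero (inj₁ h) = ⊥-elim (h (seq-0 x))
common-valuation x y z zero (inj₂ (inj₁ h)) = ⊥-elim (h (seq-0 y))
common-valuation x y z zero (inj₂ (inj₂ h)) = ⊥-elim (h (seq-0 z))
common-valuation x y z (suc k) h with seq x k ℕ.≟ 0 | seq y k ℕ.≟ 0 | seq z k ℕ.≟ 0
... | yes x0 | yes y0 | yes z0 = k , (x0 , y0 , z0) , h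
... | no x≢0 | _ | _ = common-valuation x y z k (inj₁ x≢0)
... | yes _ | no y≢0 | _ = common-valuation x y z k (inj₂ (inj₁ y≢0))
... | yes _ | yes _ | no z≢0 = common-valuation x y z k (inj₂ (inj₂ z≢0))

divide-out : ∀ (x : ℤ₃) m N → m ≤ N → seq x m ≡ 0 → seq x N ≡ (seq x N / 3 ^ m) {{nz3 m}} ℕ.* 3 ^ m
divide-out x m N m≤N x0 = trans (m≡m%n+[m/n]*n (seq x N) (3 ^ m) {{nz3 m}})
  (cong (ℕ._+ (seq x N / 3 ^ m) {{nz3 m}} ℕ.* 3 ^ m) (trans (seq-coherent x m≤N) x0))

quotient-unit : ∀ X m → red (suc m) (X ℕ.* 3 ^ m) ≢ 0 → red 1 X ≢ 0
quotient-unit X m h X0 = h (begin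
  red (suc m) (X ℕ.* 3 ^ m)                  ≡⟨ cong (λ t → red (suc m) (t ℕ.* 3 ^ m)) X≡ ⟩
  red (suc m) ((X / 3) ℕ.* 3 ℕ.* 3 ^ m)      ≡⟨ cong (red (suc m)) (ℕP.*-assoc (X / 3) 3 (3 ^ m)) ⟩
  red (suc m) ((X / 3) ℕ.* 3 ^ suc m)        ≡⟨ m*n%n≡0 (X / 3) (3 ^ suc m) {{nz3 (suc m)}} ⟩
  0                                          ∎)
  where
  open ≡-Reasoning
  X≡ : X ≡ (X / 3) ℕ.* 3
  X≡ = trans (m≡m%n+[m/n]*n X 3) (cong (ℕ._+ (X / 3) ℕ.* 3) X0)

private
  E-homogeneous : ∀ a1 a2 a3 c X Y Z t → E a1 a2 a3 c (X * t) (Y * t) (Z * t) ≡ (t * (t * t)) * E a1 a2 a3 c X Y Z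
  E-homogeneous = identity
    where
    identity : ∀ a1 a2 a3 c X Y Z t →
      ((a1 * ((X * t) * ((X * t) * ((X * t) * + 1))) + a2 * ((Y * t) * ((Y * t) * ((Y * t) * + 1)))
        + a3 * ((Z * t) * ((Z * t) * ((Z * t) * + 1)))) - c * ((X * t) * ((Y * t) * (Z * t))))
      ≡ (t * (t * t)) * ((a1 * (X * (X * (X * + 1))) + a2 * (Y * (Y * (Y * + 1))) + a3 * (Z * (Z * (Z * + 1))))
        - c * (X * (Y * Z)))
    identity = solve-∀

divide-solution : ∀ m a1 a2 a3 c X Y Z →
  p3 (m ℕ.+ (m ℕ.+ m) ℕ.+ 3) ∣ₛ E a1 a2 a3 c (X * p3 m) (Y * p3 m) (Z * p3 m) → p3 3 ∣ₛ E a1 a2 a3 c X Y Z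
divide-solution m a1 a2 a3 c X Y Z sol =
  S.*-cancelˡ-∣ (p3 (m ℕ.+ (m ℕ.+ m))) {{nz3 (m ℕ.+ (m ℕ.+ m))}}
    (subst₂ _∣ₛ_ (p3-+ (m ℕ.+ (m ℕ.+ m)) 3) scaled sol)
  where
  t : ℤ
  t = p3 m
  scaled : E a1 a2 a3 c (X * t) (Y * t) (Z * t) ≡ p3 (m ℕ.+ (m ℕ.+ m)) * E a1 a2 a3 c X Y Z
  scaled = trans (E-homogeneous a1 a2 a3 c X Y Z t)
                 (cong (_* E a1 a2 a3 c X Y Z) (sym (trans (p3-+ m (m ℕ.+ m)) (cong (t *_) (p3-+ m m)))))

Soluble⇒Primitive : ∀ u1 u2 u3 c → Soluble u1 u2 u3 c → PrimitiveSolution u1 u2 u3 c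
Soluble⇒Primitive u1 u2 u3 c (x , y , z , (k , nz) , sol) with common-valuation x y z k nz
... | m , (x0 , y0 , z0) , nz' = quotient x , quotient y , quotient z , unit nz' , mod27
  where
  N : ℕ
  N = m ℕ.+ (m ℕ.+ m) ℕ.+ 3
  m≤N : m ≤ N
  m≤N = ℕP.≤-trans (ℕP.m≤m+n m (m ℕ.+ m)) (ℕP.m≤m+n (m ℕ.+ (m ℕ.+ m)) 3)
  m+1≤N : suc m ≤ N
  m+1≤N = subst (_≤ N) (ℕP.+-comm m 1) (ℕP.+-mono-≤ (ℕP.m≤m+n m (m ℕ.+ m)) (s≤s z≤n))
  3≤N : 3 ≤ N
  3≤N = ℕP.m≤n+m 3 (m ℕ.+ (m ℕ.+ m))
  quotient : ℤ₃ → ℕ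
  quotient w = (seq w N / 3 ^ m) {{nz3 m}}
  unit-at : ∀ w → seq w m ≡ 0 → seq w (suc m) ≢ 0 → red 1 (quotient w) ≢ 0
  unit-at w w0 w≢0 = quotient-unit (quotient w) m
    (λ e → w≢0 (trans (sym (seq-coherent w m+1≤N)) (trans (cong (red (suc m)) (divide-out w m N m≤N w0)) e)))
  unit : NonzeroAt x y z (suc m) → (red 1 (quotient x) ≢ 0) ⊎ (red 1 (quotient y) ≢ 0) ⊎ (red 1 (quotient z) ≢ 0)
  unit (inj₁ h) = inj₁ (unit-at x x0 h)
  unit (inj₂ (inj₁ h)) = inj₂ (inj₁ (unit-at y y0 h))
  unit (inj₂ (inj₂ h)) = inj₂ (inj₂ (unit-at z z0 h))
  as-multiple : ∀ w → seq w m ≡ 0 → U w N ≡ + quotient w * p3 m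
  as-multiple w w0 = trans (cong +_ (divide-out w m N m≤N w0)) (ℤP.pos-* (quotient w) (3 ^ m))
  level-N : p3 N ∣ₛ E (U u1 N) (U u2 N) (U u3 N) (U c N) (+ quotient x * p3 m) (+ quotient y * p3 m) (+ quotient z * p3 m)
  level-N = subst (p3 N ∣ₛ_)
    (cong₂ (λ a b → E (U u1 N) (U u2 N) (U u3 N) (U c N) a b (+ quotient z * p3 m)) (as-multiple x x0) (as-multiple y y0))
    (subst (λ d → p3 N ∣ₛ E (U u1 N) (U u2 N) (U u3 N) (U c N) (U x N) (U y N) d) (as-multiple z z0)
      (≈0⇒∣ (Equivalence.to (Solves⇔E≈0 u1 u2 u3 c x y z) sol N)))
  mod27 : p3 3 ∣ₛ E (U u1 3) (U u2 3) (U u3 3) (U c 3) (+ quotient x) (+ quotient y) (+ quotient z)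
  mod27 = ∣-resp-≈ (≈-sym (E-cong (U-coherent u1 3≤N) (U-coherent u2 3≤N) (U-coherent u3 3≤N) (U-coherent c 3≤N)
                                  (≈-refl (+ quotient x)) (≈-refl (+ quotient y)) (≈-refl (+ quotient z))))
                   (divide-solution m (U u1 N) (U u2 N) (U u3 N) (U c N) (+ quotient x) (+ quotient y) (+ quotient z) level-N)

-- Finite facts about residues, each verified by exhaustive evaluation of a decision procedure
-- over all residues involved (the variables modulo 3 and the coefficients modulo 9 or 27).

Unit : ℕ → Set
Unit a = red 1 a ≢ 0

Val1 : ℕ → Set
Val1 a = red 1 a ≡ 0 × red 2 a ≢ 0

SignEq : ℤ → ℤ → ℤ → ℤ → ℤ → ℤ → Set
SignEq a1 a2 a3 c s1 s2 = c ≡₉ (s1 ℤ.* a1 ℤ.+ s2 ℤ.* a2 ℤ.+ (s1 ℤ.* s2) ℤ.* a3)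

SignCondition : ℤ → ℤ → ℤ → ℤ → Set
SignCondition a1 a2 a3 c = ∃[ s1 ] ∃[ s2 ] (IsSign s1 × IsSign s2 × SignEq a1 a2 a3 c s1 s2)

SignCases : ℤ → ℤ → ℤ → ℤ → Set
SignCases a1 a2 a3 c = SignEq a1 a2 a3 c (+ 1) (+ 1) ⊎ SignEq a1 a2 a3 c (+ 1) (- + 1)
                     ⊎ SignEq a1 a2 a3 c (- + 1) (+ 1) ⊎ SignEq a1 a2 a3 c (- + 1) (- + 1)

sign-cases : ∀ a1 a2 a3 c → SignCases a1 a2 a3 c ⇔ SignCondition a1 a2 a3 c
sign-cases a1 a2 a3 c = mk⇔ to from
  where
  to : SignCases a1 a2 a3 c → SignCondition a1 a2 a3 c
  to (inj₁ p) = + 1 , + 1 , inj₁ refl , inj₁ refl , p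
  to (inj₂ (inj₁ p)) = + 1 , - + 1 , inj₁ refl , inj₂ refl , p
  to (inj₂ (inj₂ (inj₁ p))) = - + 1 , + 1 , inj₂ refl , inj₁ refl , p
  to (inj₂ (inj₂ (inj₂ p))) = - + 1 , - + 1 , inj₂ refl , inj₂ refl , p
  from : SignCondition a1 a2 a3 c → SignCases a1 a2 a3 c
  from (_ , _ , inj₁ refl , inj₁ refl , p) = inj₁ p
  from (_ , _ , inj₁ refl , inj₂ refl , p) = inj₂ (inj₁ p)
  from (_ , _ , inj₂ refl , inj₁ refl , p) = inj₂ (inj₂ (inj₁ p))
  from (_ , _ , inj₂ refl , inj₂ refl , p) = inj₂ (inj₂ (inj₂ p))

PairCondition : ℤ → ℤ → ℤ → Set
PairCondition a1 a2 a3 = (a1 ≡±₉ a2) ⊎ (a1 ≡±₉ a3) ⊎ (a2 ≡±₉ a3)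

Witness : (ℕ → ℕ → ℕ → Set) → Set
Witness P = ∃ λ X → X < 3 × ∃ λ Y → Y < 3 × ∃ λ t → t < 3 × P X Y t

SimpleRootMod9 : (a1 a2 a3 c : ℕ) → Set
SimpleRootMod9 a1 a2 a3 c = Witness λ X Y t → ((X ≢ 0) ⊎ (Y ≢ 0)) ×
  (+ 9 ∣ₛ E (+ a1) (+ a2) (+ a3) (+ c) (+ X) (+ Y) (+ t)) × ExactVal 1 (+ 3 * + a3 * (+ t * + t) - + c * (+ X * + Y))

module _ where
  private
    ≢0? : ∀ a → Dec (a ≢ 0)
    ≢0? a = ¬? (a ℕ.≟ 0)
    ≡0? : ∀ a → Dec (a ≡ 0)
    ≡0? a = a ℕ.≟ 0
    unit? : ∀ a → Dec (Unit a)
    unit? a = ≢0? (red 1 a)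
    val1? : ∀ a → Dec (Val1 a)
    val1? a = ≡0? (red 1 a) ×-dec ≢0? (red 2 a)
    ≡₉? : ∀ a b → Dec (a ≡₉ b)
    ≡₉? a b = 9 ℕ∣.∣? ℤ.∣ a - b ∣
    ≡±₉? : ∀ a b → Dec (a ≡±₉ b)
    ≡±₉? a b = ≡₉? a b ⊎-dec ≡₉? a (- b)
    pair? : ∀ a1 a2 a3 → Dec (PairCondition a1 a2 a3)
    pair? a1 a2 a3 = ≡±₉? a1 a2 ⊎-dec (≡±₉? a1 a3 ⊎-dec ≡±₉? a2 a3)
    exact? : ∀ e q → Dec (ExactVal e q)
    exact? e q = (p3 e ∣? q) ×-dec ¬? (p3 (suc e) ∣? q)
    all< : ∀ {P : ℕ → Set} n → (∀ a → Dec (P a)) → Dec (∀ {a} → a < n → P a)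
    all< n P? = ℕP.allUpTo? P? n
    any< : ∀ {P : ℕ → Set} n → (∀ a → Dec (P a)) → Dec (∃ λ a → a < n × P a)
    any< n P? = ℕP.anyUpTo? P? n
    simple-root? : ∀ a1 a2 a3 c → Dec (SimpleRootMod9 a1 a2 a3 c)
    simple-root? a1 a2 a3 c = any< 3 λ X → any< 3 λ Y → any< 3 λ t → (≢0? X ⊎-dec ≢0? Y) ×-dec
      ((+ 9 ∣? E (+ a1) (+ a2) (+ a3) (+ c) (+ X) (+ Y) (+ t)) ×-dec exact? 1 (+ 3 * + a3 * (+ t * + t) - + c * (+ X * + Y)))
    sign? : ∀ a1 a2 a3 c → Dec (SignCondition a1 a2 a3 c)
    sign? a1 a2 a3 c = map′ (Equivalence.to (sign-cases a1 a2 a3 c)) (Equivalence.from (sign-cases a1 a2 a3 c))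
      (eq? (+ 1) (+ 1) ⊎-dec (eq? (+ 1) (- + 1) ⊎-dec (eq? (- + 1) (+ 1) ⊎-dec eq? (- + 1) (- + 1))))
      where
      eq? : ∀ s1 s2 → Dec (SignEq a1 a2 a3 c s1 s2)
      eq? s1 s2 = ≡₉? c (s1 ℤ.* a1 ℤ.+ s2 ℤ.* a2 ℤ.+ (s1 ℤ.* s2) ℤ.* a3)

  opaque
    unit-cube-mod3 : ∀ {a1} → a1 < 3 → a1 ≢ 0 → ∀ {x} → x < 3 → ∀ {y} → y < 3 → ∀ {z} → z < 3 →
      + 3 ∣ₛ E (+ a1) (+ 0) (+ 0) (+ 0) (+ x) (+ y) (+ z) → x ≡ 0
    unit-cube-mod3 = toWitness {a? = all< 3 λ a1 → ≢0? a1 →-dec all< 3 λ x → all< 3 λ y → all< 3 λ z →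
      (+ 3 ∣? E (+ a1) (+ 0) (+ 0) (+ 0) (+ x) (+ y) (+ z)) →-dec ≡0? x} tt

  opaque
    two-units-mod3 : ∀ {a1} → a1 < 3 → a1 ≢ 0 → ∀ {a2} → a2 < 3 → a2 ≢ 0 →
      ∀ {x} → x < 3 → ∀ {y} → y < 3 → ∀ {z} → z < 3 →
      + 3 ∣ₛ E (+ a1) (+ a2) (+ 0) (+ 0) (+ x) (+ y) (+ z) → (x ≢ 0 × y ≢ 0) ⊎ (x ≡ 0 × y ≡ 0)
    two-units-mod3 = toWitness {a? = all< 3 λ a1 → ≢0? a1 →-dec all< 3 λ a2 → ≢0? a2 →-dec
      all< 3 λ x → all< 3 λ y → all< 3 λ z →
      (+ 3 ∣? E (+ a1) (+ a2) (+ 0) (+ 0) (+ x) (+ y) (+ z)) →-dec ((≢0? x ×-dec ≢0? y) ⊎-dec (≡0? x ×-dec ≡0? y))} tt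

  opaque
    three-units-mod9 : ∀ {a1} → a1 < 9 → Unit a1 → ∀ {a2} → a2 < 9 → Unit a2 → ∀ {a3} → a3 < 9 → Unit a3 →
      ∀ {x} → x < 3 → ∀ {y} → y < 3 → ∀ {z} → z < 3 → (x ≢ 0) ⊎ (y ≢ 0) ⊎ (z ≢ 0) →
      + 9 ∣ₛ E (+ a1) (+ a2) (+ a3) (+ 0) (+ x) (+ y) (+ z) → PairCondition (+ a1) (+ a2) (+ a3)
    three-units-mod9 = toWitness {a? = all< 9 λ a1 → unit? a1 →-dec all< 9 λ a2 → unit? a2 →-dec
      all< 9 λ a3 → unit? a3 →-dec all< 3 λ x → all< 3 λ y → all< 3 λ z →
      (≢0? x ⊎-dec (≢0? y ⊎-dec ≢0? z)) →-dec
      ((+ 9 ∣? E (+ a1) (+ a2) (+ a3) (+ 0) (+ x) (+ y) (+ z)) →-dec pair? (+ a1) (+ a2) (+ a3))} tt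

  opaque
    two-units-mod9 : ∀ {a1} → a1 < 9 → Unit a1 → ∀ {a2} → a2 < 9 → Unit a2 →
      ∀ {x} → x < 3 → ∀ {y} → y < 3 → ∀ {z} → z < 3 →
      + 9 ∣ₛ E (+ a1) (+ a2) (+ 0) (+ 0) (+ x) (+ y) (+ z) → ((+ a1) ≡±₉ (+ a2)) ⊎ (x ≡ 0 × y ≡ 0)
    two-units-mod9 = toWitness {a? = all< 9 λ a1 → unit? a1 →-dec all< 9 λ a2 → unit? a2 →-dec
      all< 3 λ x → all< 3 λ y → all< 3 λ z →
      ((+ 9 ∣? E (+ a1) (+ a2) (+ 0) (+ 0) (+ x) (+ y) (+ z)) →-dec (≡±₉? (+ a1) (+ a2) ⊎-dec (≡0? x ×-dec ≡0? y)))} tt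

  opaque
    sign-condition-mod9 : ∀ {a1} → a1 < 9 → Unit a1 → ∀ {a2} → a2 < 9 → Unit a2 → ∀ {a3} → a3 < 9 → red 1 a3 ≡ 0 →
      ∀ {c} → c < 9 → red 1 c ≡ 0 → c ≢ 0 → ∀ {x} → x < 3 → x ≢ 0 → ∀ {y} → y < 3 → y ≢ 0 → ∀ {z} → z < 3 →
      + 9 ∣ₛ E (+ a1) (+ a2) (+ a3) (+ c) (+ x) (+ y) (+ z) → ((+ a1) ≡±₉ (+ a2)) ⊎ SignCondition (+ a1) (+ a2) (+ a3) (+ c)
    sign-condition-mod9 = toWitness {a? = all< 9 λ a1 → unit? a1 →-dec all< 9 λ a2 → unit? a2 →-dec
      all< 9 λ a3 → ≡0? (red 1 a3) →-dec all< 9 λ c → ≡0? (red 1 c) →-dec (≢0? c →-dec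
      all< 3 λ x → ≢0? x →-dec all< 3 λ y → ≢0? y →-dec all< 3 λ z →
      ((+ 9 ∣? E (+ a1) (+ a2) (+ a3) (+ c) (+ x) (+ y) (+ z)) →-dec
       (≡±₉? (+ a1) (+ a2) ⊎-dec sign? (+ a1) (+ a2) (+ a3) (+ c))))} tt

  opaque
    valuation-cube-mod27 : ∀ {a3} → a3 < 27 → red 1 a3 ≡ 0 → a3 ≢ 0 → ∀ {z} → z < 3 → z ≢ 0 →
      ¬ (+ 27 ∣ₛ + a3 * cube (+ z))
    valuation-cube-mod27 = toWitness {a? = all< 27 λ a3 → ≡0? (red 1 a3) →-dec (≢0? a3 →-dec
      all< 3 λ z → ≢0? z →-dec ¬? (+ 27 ∣? + a3 * cube (+ z)))} tt

  opaque
    two-val1-mod27 : ∀ {a2} → a2 < 27 → Val1 a2 → ∀ {a3} → a3 < 27 → Val1 a3 →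
      ∀ {y} → y < 3 → ∀ {z} → z < 3 → (y ≢ 0) ⊎ (z ≢ 0) →
      + 27 ∣ₛ (+ a2 * cube (+ y) + + a3 * cube (+ z)) → (+ (a2 / 3)) ≡±₉ (+ (a3 / 3))
    two-val1-mod27 = toWitness {a? = all< 27 λ a2 → val1? a2 →-dec all< 27 λ a3 → val1? a3 →-dec
      all< 3 λ y → all< 3 λ z → (≢0? y ⊎-dec ≢0? z) →-dec
      ((+ 27 ∣? (+ a2 * cube (+ y) + + a3 * cube (+ z))) →-dec ≡±₉? (+ (a2 / 3)) (+ (a3 / 3)))} tt

  opaque
    pair-root : ∀ {a} → a < 9 → Unit a → ∀ {b} → b < 9 → Unit b → (+ a) ≡±₉ (+ b) →
      ∃ λ t → t < 3 × (+ 9 ∣ₛ (+ a + + b * cube (+ t))) × ExactVal 1 (+ 3 * + b * (+ t * + t))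
    pair-root = toWitness {a? = all< 9 λ a → unit? a →-dec all< 9 λ b → unit? b →-dec (≡±₉? (+ a) (+ b) →-dec
      any< 3 λ t → (+ 9 ∣? (+ a + + b * cube (+ t))) ×-dec exact? 1 (+ 3 * + b * (+ t * + t)))} tt

  opaque
    val1-pair-root : ∀ {a2} → a2 < 27 → Val1 a2 → ∀ {a3} → a3 < 27 → Val1 a3 → (+ (a2 / 3)) ≡±₉ (+ (a3 / 3)) →
      ∃ λ t → t < 3 × (+ 27 ∣ₛ (+ a2 + + a3 * cube (+ t))) × ExactVal 2 (+ 3 * + a3 * (+ t * + t))
    val1-pair-root = toWitness {a? = all< 27 λ a2 → val1? a2 →-dec all< 27 λ a3 → val1? a3 →-dec
      (≡±₉? (+ (a2 / 3)) (+ (a3 / 3)) →-dec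
      any< 3 λ t → (+ 27 ∣? (+ a2 + + a3 * cube (+ t))) ×-dec exact? 2 (+ 3 * + a3 * (+ t * + t)))} tt

  opaque
    units-val1-root : ∀ {a1} → a1 < 9 → Unit a1 → ∀ {a2} → a2 < 9 → Unit a2 →
      ∀ {a3} → a3 < 9 → red 1 a3 ≡ 0 → a3 ≢ 0 → SimpleRootMod9 a3 a2 a1 0
    units-val1-root = toWitness {a? = all< 9 λ a1 → unit? a1 →-dec all< 9 λ a2 → unit? a2 →-dec
      all< 9 λ a3 → ≡0? (red 1 a3) →-dec (≢0? a3 →-dec simple-root? a3 a2 a1 0)} tt

  opaque
    sign-root : ∀ {a1} → a1 < 9 → Unit a1 → ∀ {a2} → a2 < 9 → Unit a2 → ∀ {a3} → a3 < 9 → red 1 a3 ≡ 0 →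
      ∀ {c} → c < 9 → red 1 c ≡ 0 → c ≢ 0 → SignCondition (+ a1) (+ a2) (+ a3) (+ c) → SimpleRootMod9 a1 a2 a3 c
    sign-root = toWitness {a? = all< 9 λ a1 → unit? a1 →-dec all< 9 λ a2 → unit? a2 →-dec
      all< 9 λ a3 → ≡0? (red 1 a3) →-dec all< 9 λ c → ≡0? (red 1 c) →-dec (≢0? c →-dec
      (sign? (+ a1) (+ a2) (+ a3) (+ c) →-dec simple-root? a1 a2 a3 c))} tt

  opaque
    val1-root : ∀ {a1} → a1 < 9 → Unit a1 → ∀ {a2} → a2 < 9 → red 1 a2 ≡ 0 → a2 ≢ 0 →
      ∀ {a3} → a3 < 9 → red 1 a3 ≡ 0 → a3 ≢ 0 → ∀ {c} → c < 9 → red 1 c ≡ 0 → c ≢ 0 → SimpleRootMod9 a3 a2 a1 c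
    val1-root = toWitness {a? = all< 9 λ a1 → unit? a1 →-dec all< 9 λ a2 → ≡0? (red 1 a2) →-dec (≢0? a2 →-dec
      all< 9 λ a3 → ≡0? (red 1 a3) →-dec (≢0? a3 →-dec all< 9 λ c → ≡0? (red 1 c) →-dec (≢0? c →-dec
      simple-root? a3 a2 a1 c)))} tt

cube-lift : ∀ t {X x} → X ≈[ + 3 * t ] x → cube X ≈[ + 3 * (+ 3 * t) ] cube x
cube-lift t {X} {x} (mk≈ (divides s X-x≡)) = mk≈ (divides (s * (x * x + x * s * (+ 3 * t)) + s * s * s * t * (+ 3 * t)) (begin
  cube X - cube x                                    ≡⟨ cong (λ X → cube X - cube x) (from-difference X x) ⟩
  cube (x + (X - x)) - cube x                        ≡⟨ cong (λ d → cube (x + d) - cube x) X-x≡ ⟩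
  cube (x + s * (+ 3 * t)) - cube x                  ≡⟨ expand x s t ⟩
  (s * (x * x + x * s * (+ 3 * t)) + s * s * s * t * (+ 3 * t)) * (+ 3 * (+ 3 * t)) ∎))
  where
  open ≡-Reasoning
  from-difference : ∀ X x → X ≡ x + (X - x)
  from-difference = solve-∀
  expand : ∀ x s t → ((x + s * (+ 3 * t)) * ((x + s * (+ 3 * t)) * ((x + s * (+ 3 * t)) * + 1))) - (x * (x * (x * + 1)))
    ≡ (s * (x * x + x * s * (+ 3 * t)) + s * s * s * t * (+ 3 * t)) * (+ 3 * (+ 3 * t))
  expand = solve-∀

cube-27 : ∀ X → + 3 ∣ₛ X → + 27 ∣ₛ cube X
cube-27 X (divides q refl) = divides (cube q) (expand q)
  where
  expand : ∀ q → (q * + 3) * ((q * + 3) * ((q * + 3) * + 1)) ≡ (q * (q * (q * + 1))) * + 27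
  expand = solve-∀

module Reduction (u1 u2 u3 c : ℤ₃) (X Y Z : ℕ)
  (sol : p3 3 ∣ₛ E (U u1 3) (U u2 3) (U u3 3) (U c 3) (+ X) (+ Y) (+ Z)) where

  x y z : ℕ
  x = red 1 X
  y = red 1 Y
  z = red 1 Z

  mod3 : + 3 ∣ₛ E (U u1 1) (U u2 1) (U u3 1) (U c 1) (+ x) (+ y) (+ z)
  mod3 = ∣-resp-≈ (≈-sym (E-cong (U-coherent u1 1≤3) (U-coherent u2 1≤3) (U-coherent u3 1≤3) (U-coherent c 1≤3)
                                 (≈red X 1) (≈red Y 1) (≈red Z 1)))
                  (S.∣-trans (divides (+ 9) refl) sol)
    where
    1≤3 : 1 ≤ 3
    1≤3 = s≤s z≤n

  -- modulo 9, when 3 ∣ c: the cubes only depend on the residues mod 3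
  mod9 : + 3 ∣ₛ U c 2 → + 9 ∣ₛ E (U u1 2) (U u2 2) (U u3 2) (U c 2) (+ x) (+ y) (+ z)
  mod9 3∣c = ∣-resp-≈ (≈-trans (≈-sym residues) coefficients)
                     (S.∣-trans (divides (+ 3) refl) sol)
    where
    2≤3 : 2 ≤ 3
    2≤3 = s≤s (s≤s z≤n)
    coefficients : E (U u1 2) (U u2 2) (U u3 2) (U c 2) (+ X) (+ Y) (+ Z) ≈[ + 9 ] E (U u1 3) (U u2 3) (U u3 3) (U c 3) (+ X) (+ Y) (+ Z)
    coefficients = ≈-sym (E-cong (U-coherent u1 2≤3) (U-coherent u2 2≤3) (U-coherent u3 2≤3) (U-coherent c 2≤3)
                                 (≈-refl (+ X)) (≈-refl (+ Y)) (≈-refl (+ Z)))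
    residues : E (U u1 2) (U u2 2) (U u3 2) (U c 2) (+ X) (+ Y) (+ Z) ≈[ + 9 ] E (U u1 2) (U u2 2) (U u3 2) (U c 2) (+ x) (+ y) (+ z)
    residues = ≈-- (≈-+ (≈-+ (≈-* (≈-refl (U u1 2)) (cube-lift (+ 1) (≈red X 1)))
                              (≈-* (≈-refl (U u2 2)) (cube-lift (+ 1) (≈red Y 1))))
                        (≈-* (≈-refl (U u3 2)) (cube-lift (+ 1) (≈red Z 1))))
                   (*-≈-scale (U c 2) 3∣c (≈-* (≈red X 1) (≈-* (≈red Y 1) (≈red Z 1))))

  private
    without-last-two : ∀ a1 a2 a3 c X Y Z → E a1 a2 a3 c X Y Z - (a2 * cube Y + a3 * cube Z) ≡ a1 * cube X - c * (X * (Y * Z))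
    without-last-two = identity
      where
      identity : ∀ a1 a2 a3 c X Y Z →
        ((a1 * (X * (X * (X * + 1))) + a2 * (Y * (Y * (Y * + 1))) + a3 * (Z * (Z * (Z * + 1)))) - c * (X * (Y * Z)))
        - (a2 * (Y * (Y * (Y * + 1))) + a3 * (Z * (Z * (Z * + 1)))) ≡ a1 * (X * (X * (X * + 1))) - c * (X * (Y * Z))
      identity = solve-∀
    without-last : ∀ a1 a2 a3 c X Y Z → E a1 a2 a3 c X Y Z - a3 * cube Z ≡ a1 * cube X + a2 * cube Y - c * (X * (Y * Z))
    without-last = identity
      where
      identity : ∀ a1 a2 a3 c X Y Z →
        ((a1 * (X * (X * (X * + 1))) + a2 * (Y * (Y * (Y * + 1))) + a3 * (Z * (Z * (Z * + 1)))) - c * (X * (Y * Z)))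
        - a3 * (Z * (Z * (Z * + 1))) ≡ a1 * (X * (X * (X * + 1))) + a2 * (Y * (Y * (Y * + 1))) - c * (X * (Y * Z))
      identity = solve-∀
    27∣cXYZ : ∀ c X Y Z → + 3 ∣ₛ c → + 3 ∣ₛ X → + 3 ∣ₛ Y → + 27 ∣ₛ c * (X * (Y * Z))
    27∣cXYZ _ _ _ Z (divides c refl) (divides x refl) (divides y refl) = divides (c * (x * (y * Z))) (regroup c x y Z)
      where
      regroup : ∀ c x y Z → c * + 3 * (x * + 3 * (y * + 3 * Z)) ≡ c * (x * (y * Z)) * + 27
      regroup = solve-∀
    27∣cXYZ′ : ∀ c X Y Z → + 9 ∣ₛ c → + 3 ∣ₛ X → + 27 ∣ₛ c * (X * (Y * Z))
    27∣cXYZ′ _ _ Y Z (divides c refl) (divides x refl) = divides (c * (x * (Y * Z))) (regroup c x Y Z)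
      where
      regroup : ∀ c x Y Z → c * + 9 * (x * + 3 * (Y * Z)) ≡ c * (x * (Y * Z)) * + 27
      regroup = solve-∀
    residue-term : ∀ a W → + 3 ∣ₛ a → a * cube (+ W) ≈[ + 27 ] a * cube (+ red 1 W)
    residue-term a W 3∣a = *-≈-scale a 3∣a (cube-lift (+ 1) (≈red W 1))

  last-two-terms : red 1 X ≡ 0 → + 9 ∣ₛ U c 3 → + 3 ∣ₛ U u2 3 → + 3 ∣ₛ U u3 3 →
    + 27 ∣ₛ U u2 3 * cube (+ y) + U u3 3 * cube (+ z)
  last-two-terms x0 9∣c 3∣u2 3∣u3 =
    ∣-resp-≈ (≈-sym (≈-+ (residue-term (U u2 3) Y 3∣u2) (residue-term (U u3 3) Z 3∣u3)))
      (∣-resp-≈ (≈-sym (mk≈ (subst (+ 27 ∣ₛ_) (sym (without-last-two (U u1 3) (U u2 3) (U u3 3) (U c 3) (+ X) (+ Y) (+ Z)))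
                                  (S.∣m∣n⇒∣m-n (S.∣n⇒∣m*n (U u1 3) (cube-27 (+ X) 3∣X)) (27∣cXYZ′ (U c 3) (+ X) (+ Y) (+ Z) 9∣c 3∣X)))))
                sol)
    where
    3∣X : + 3 ∣ₛ + X
    3∣X = red1≡0⇒3∣ X x0

  last-term : red 1 X ≡ 0 → red 1 Y ≡ 0 → + 3 ∣ₛ U c 3 → + 3 ∣ₛ U u3 3 → + 27 ∣ₛ U u3 3 * cube (+ z)
  last-term x0 y0 3∣c 3∣u3 =
    ∣-resp-≈ (≈-sym (residue-term (U u3 3) Z 3∣u3))
      (∣-resp-≈ (≈-sym (mk≈ (subst (+ 27 ∣ₛ_) (sym (without-last (U u1 3) (U u2 3) (U u3 3) (U c 3) (+ X) (+ Y) (+ Z)))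
                                  (S.∣m∣n⇒∣m-n (S.∣m∣n⇒∣m+n (S.∣n⇒∣m*n (U u1 3) (cube-27 (+ X) 3∣X)) (S.∣n⇒∣m*n (U u2 3) (cube-27 (+ Y) 3∣Y)))
                                               (27∣cXYZ (U c 3) (+ X) (+ Y) (+ Z) 3∣c 3∣X 3∣Y)))))
                sol)
    where
    3∣X : + 3 ∣ₛ + X
    3∣X = red1≡0⇒3∣ X x0
    3∣Y : + 3 ∣ₛ + Y
    3∣Y = red1≡0⇒3∣ Y y0

residue<3 : ∀ X → red 1 X < 3
residue<3 X = m%n<n X 3

vanishing-level : ∀ {m} (u : ℤ₃) k → seq u k ≡ 0 → m ∣ₛ U u k
vanishing-level {m} u k u0 = subst (m ∣ₛ_) (sym (cong +_ u0)) (divides (+ 0) refl)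

val1-mod27 : ∀ (u : ℤ₃) → HasVal (seq u) 1 → Val1 (seq u 3)
val1-mod27 u h = seq-div3 u 3 (HasVal⇒zero u h ℕP.≤-refl) ,
                 λ e → HasVal⇒nonzero u h ℕP.≤-refl (trans (sym (seq-coherent u (s≤s (s≤s z≤n)))) e)

-- If 1 ≤ v(u3) ≤ 2 and 3 ∣ c, no primitive solution has x ≡ y ≡ 0 (mod 3):
-- otherwise 27 ∣ u3 z³ with z a unit.
not-only-z : ∀ u1 u2 u3 c {v3} → HasVal (seq u3) v3 → 1 ≤ v3 → v3 ≤ 2 → seq c 1 ≡ 0 →
  ∀ X Y Z → ((red 1 X ≢ 0) ⊎ (red 1 Y ≢ 0) ⊎ (red 1 Z ≢ 0)) →
  p3 3 ∣ₛ E (U u1 3) (U u2 3) (U u3 3) (U c 3) (+ X) (+ Y) (+ Z) → red 1 X ≡ 0 → red 1 Y ≡ 0 → ⊥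
not-only-z u1 u2 u3 c h3 1≤v3 v3≤2 c0 X Y Z nz sol x0 y0 =
  valuation-cube-mod27 (bounded u3 3) u3≡0mod3 (HasVal⇒nonzero u3 h3 (s≤s v3≤2)) (residue<3 Z) (z-unit nz)
    (last-term x0 y0 (red1≡0⇒3∣ (seq c 3) (seq-div3 c 3 c0)) (red1≡0⇒3∣ (seq u3 3) u3≡0mod3))
  where
  open Reduction u1 u2 u3 c X Y Z sol
  u3≡0mod3 : red 1 (seq u3 3) ≡ 0
  u3≡0mod3 = seq-div3 u3 3 (HasVal⇒zero u3 h3 1≤v3)
  z-unit : ((red 1 X ≢ 0) ⊎ (red 1 Y ≢ 0) ⊎ (red 1 Z ≢ 0)) → red 1 Z ≢ 0
  z-unit (inj₁ x≢0) = ⊥-elim (x≢0 x0)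
  z-unit (inj₂ (inj₁ y≢0)) = ⊥-elim (y≢0 y0)
  z-unit (inj₂ (inj₂ z≢0)) = z≢0

necessary-1 : ∀ u1 u2 u3 c → HasVal (seq u1) 0 → HasVal (seq u2) 0 → HasVal (seq u3) 0 → seq c 2 ≡ 0 →
  PrimitiveSolution u1 u2 u3 c → PairCondition (r9 u1) (r9 u2) (r9 u3)
necessary-1 u1 u2 u3 c h1 h2 h3 c0 (X , Y , Z , nz , sol) =
  three-units-mod9 (bounded u1 2) (unit-mod9 u1 h1) (bounded u2 2) (unit-mod9 u2 h2) (bounded u3 2) (unit-mod9 u3 h3)
    (residue<3 X) (residue<3 Y) (residue<3 Z) nz
    (subst (λ c → + 9 ∣ₛ E (U u1 2) (U u2 2) (U u3 2) c (+ x) (+ y) (+ z)) (cong +_ c0) (mod9 (vanishing-level c 2 c0)))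
  where open Reduction u1 u2 u3 c X Y Z sol

-- Necessity in case (2) with v(u3) = 2: reduce modulo 9, where u3 and c disappear.
necessary-2 : ∀ u1 u2 u3 c → HasVal (seq u1) 0 → HasVal (seq u2) 0 → HasVal (seq u3) 2 → seq c 2 ≡ 0 →
  PrimitiveSolution u1 u2 u3 c → r9 u1 ≡±₉ r9 u2
necessary-2 u1 u2 u3 c h1 h2 h3 c0 (X , Y , Z , nz , sol) = conclude
  (two-units-mod9 (bounded u1 2) (unit-mod9 u1 h1) (bounded u2 2) (unit-mod9 u2 h2) (residue<3 X) (residue<3 Y) (residue<3 Z)
    (subst₂ (λ a c → + 9 ∣ₛ E (U u1 2) (U u2 2) a c (+ x) (+ y) (+ z)) (cong +_ (HasVal⇒zero u3 h3 ℕP.≤-refl)) (cong +_ c0)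
            (mod9 (vanishing-level c 2 c0))))
  where
  open Reduction u1 u2 u3 c X Y Z sol
  conclude : (r9 u1 ≡±₉ r9 u2) ⊎ (x ≡ 0 × y ≡ 0) → r9 u1 ≡±₉ r9 u2
  conclude (inj₁ pair) = pair
  conclude (inj₂ (x0 , y0)) =
    ⊥-elim (not-only-z u1 u2 u3 c h3 (s≤s z≤n) ℕP.≤-refl (seq-zero-down c (s≤s z≤n) c0) X Y Z nz sol x0 y0)

-- Necessity in case (3): modulo 3 forces x ≡ 0, then modulo 27 only u2 y³ + u3 z³ remains.
necessary-3 : ∀ u1 u2 u3 c → HasVal (seq u1) 0 → HasVal (seq u2) 1 → HasVal (seq u3) 1 → seq c 2 ≡ 0 →
  PrimitiveSolution u1 u2 u3 c → r9/3 u2 ≡±₉ r9/3 u3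
necessary-3 u1 u2 u3 c h1 h2 h3 c0 (X , Y , Z , nz , sol) =
  two-val1-mod27 (bounded u2 3) (val1-mod27 u2 h2) (bounded u3 3) (val1-mod27 u3 h3) (residue<3 Y) (residue<3 Z) (yz-unit nz)
    (last-two-terms x0 (red2≡0⇒9∣ (seq c 3) (trans (seq-coherent c (s≤s (s≤s z≤n))) c0))
       (red1≡0⇒3∣ (seq u2 3) (proj₁ (val1-mod27 u2 h2))) (red1≡0⇒3∣ (seq u3 3) (proj₁ (val1-mod27 u3 h3))))
  where
  open Reduction u1 u2 u3 c X Y Z sol
  x0 : x ≡ 0
  x0 = unit-cube-mod3 (bounded u1 1) (unit-mod3 u1 h1) (residue<3 X) (residue<3 Y) (residue<3 Z)
         (subst (λ a2 → + 3 ∣ₛ E (U u1 1) a2 (+ 0) (+ 0) (+ x) (+ y) (+ z)) (cong +_ (HasVal⇒zero u2 h2 ℕP.≤-refl))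
           (subst₂ (λ a3 c → + 3 ∣ₛ E (U u1 1) (U u2 1) a3 c (+ x) (+ y) (+ z))
                   (cong +_ (HasVal⇒zero u3 h3 ℕP.≤-refl)) (cong +_ (seq-zero-down c (s≤s z≤n) c0)) mod3))
  yz-unit : ((x ≢ 0) ⊎ (y ≢ 0) ⊎ (z ≢ 0)) → (y ≢ 0) ⊎ (z ≢ 0)
  yz-unit (inj₁ x≢0) = ⊥-elim (x≢0 x0)
  yz-unit (inj₂ yz) = yz

-- Necessity in case (4): modulo 3, x and y are both units or both divisible by 3; the latter
-- is impossible, and for units reduction modulo 9 gives the condition.
necessary-4 : ∀ u1 u2 u3 c {v3} → HasVal (seq u1) 0 → HasVal (seq u2) 0 → HasVal (seq u3) v3 → 1 ≤ v3 → v3 ≤ 2 →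
  HasVal (seq c) 1 → PrimitiveSolution u1 u2 u3 c → (r9 u1 ≡±₉ r9 u2) ⊎ SignCondition (r9 u1) (r9 u2) (r9 u3) (r9 c)
necessary-4 u1 u2 u3 c h1 h2 h3 1≤v3 v3≤2 hc (X , Y , Z , nz , sol) = conclude
  (two-units-mod3 (bounded u1 1) (unit-mod3 u1 h1) (bounded u2 1) (unit-mod3 u2 h2) (residue<3 X) (residue<3 Y) (residue<3 Z)
    (subst₂ (λ a3 c → + 3 ∣ₛ E (U u1 1) (U u2 1) a3 c (+ x) (+ y) (+ z))
            (cong +_ (HasVal⇒zero u3 h3 1≤v3)) (cong +_ c≡0) mod3))
  where
  open Reduction u1 u2 u3 c X Y Z sol
  c≡0 : seq c 1 ≡ 0
  c≡0 = HasVal⇒zero c hc ℕP.≤-refl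
  conclude : (x ≢ 0 × y ≢ 0) ⊎ (x ≡ 0 × y ≡ 0) → (r9 u1 ≡±₉ r9 u2) ⊎ SignCondition (r9 u1) (r9 u2) (r9 u3) (r9 c)
  conclude (inj₂ (x0 , y0)) = ⊥-elim (not-only-z u1 u2 u3 c h3 1≤v3 v3≤2 c≡0 X Y Z nz sol x0 y0)
  conclude (inj₁ (x≢0 , y≢0)) =
    sign-condition-mod9 (bounded u1 2) (unit-mod9 u1 h1) (bounded u2 2) (unit-mod9 u2 h2)
      (bounded u3 2) (seq-div3 u3 2 (HasVal⇒zero u3 h3 1≤v3))
      (bounded c 2) (seq-div3 c 2 c≡0) (HasVal⇒nonzero c hc ℕP.≤-refl)
      (residue<3 X) x≢0 (residue<3 Y) y≢0 (residue<3 Z)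
      (mod9 (red1≡0⇒3∣ (seq c 2) (seq-div3 c 2 c≡0)))

module _ where
  private
    E-at-1-0 : ∀ a1 a2 a3 c t → E a1 a2 a3 c (+ 1) (+ 0) t ≡ a1 + a3 * cube t
    E-at-1-0 = identity
      where
      identity : ∀ a1 a2 a3 c t → (a1 * (+ 1 * (+ 1 * (+ 1 * + 1))) + a2 * (+ 0 * (+ 0 * (+ 0 * + 1)))
        + a3 * (t * (t * (t * + 1)))) - c * (+ 1 * (+ 0 * t)) ≡ a1 + a3 * (t * (t * (t * + 1)))
      identity = solve-∀
    E-at-0-1 : ∀ a1 a2 a3 c t → E a1 a2 a3 c (+ 0) (+ 1) t ≡ a2 + a3 * cube t
    E-at-0-1 = identity
      where
      identity : ∀ a1 a2 a3 c t → (a1 * (+ 0 * (+ 0 * (+ 0 * + 1))) + a2 * (+ 1 * (+ 1 * (+ 1 * + 1)))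
        + a3 * (t * (t * (t * + 1)))) - c * (+ 0 * (+ 1 * t)) ≡ a2 + a3 * (t * (t * (t * + 1)))
      identity = solve-∀
    slope-1-0 : ∀ b c t → + 3 * b * (t * t) - c * (+ 1 * + 0) ≡ + 3 * b * (t * t)
    slope-1-0 = solve-∀
    slope-0-1 : ∀ b c t → + 3 * b * (t * t) - c * (+ 0 * + 1) ≡ + 3 * b * (t * t)
    slope-0-1 = solve-∀
    1<3 : 1 < 3
    1<3 = s≤s (s≤s z≤n)

  pair-soluble : ∀ u k u' c → HasVal (seq u) 0 → HasVal (seq u') 0 → r9 u ≡±₉ r9 u' → Soluble u k u' c
  pair-soluble u k u' c h h' pair
    with pair-root (bounded u 2) (unit-mod9 u h) (bounded u' 2) (unit-mod9 u' h') pair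
  ... | t , _ , root , slope = SimpleRoot⇒Soluble 1 u k u' c record
    { X = 1 ; Y = 0 ; t = t
    ; nontrivial = inj₁ (1<3 , λ ())
    ; root = subst (+ 9 ∣ₛ_) (sym (E-at-1-0 (U u 2) (U k 2) (U u' 2) (U c 2) (+ t))) root
    ; small-u3 = divides (U u' 2) (ℤP.*-comm (+ 9) (U u' 2))
    ; slope = subst (ExactVal 1) (sym (slope-1-0 (U u' 2) (U c 2) (+ t))) slope }

  val1-pair-soluble : ∀ u1 u2 u3 c → HasVal (seq u2) 1 → HasVal (seq u3) 1 → r9/3 u2 ≡±₉ r9/3 u3 → Soluble u1 u2 u3 c
  val1-pair-soluble u1 u2 u3 c h2 h3 pair
    with val1-pair-root (bounded u2 3) (val1-mod27 u2 h2) (bounded u3 3) (val1-mod27 u3 h3) pair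
  ... | t , _ , root , slope = SimpleRoot⇒Soluble 2 u1 u2 u3 c record
    { X = 0 ; Y = 1 ; t = t
    ; nontrivial = inj₂ (1<3 , λ ())
    ; root = subst (+ 27 ∣ₛ_) (sym (E-at-0-1 (U u1 3) (U u2 3) (U u3 3) (U c 3) (+ t))) root
    ; small-u3 = S.*-monoʳ-∣ (+ 9) (red1≡0⇒3∣ (seq u3 3) (proj₁ (val1-mod27 u3 h3)))
    ; slope = subst (ExactVal 2) (sym (slope-0-1 (U u3 3) (U c 3) (+ t))) slope }

  mod9-root-soluble : ∀ u1 u2 u3 c → SimpleRootMod9 (seq u1 2) (seq u2 2) (seq u3 2) (seq c 2) → Soluble u1 u2 u3 c
  mod9-root-soluble u1 u2 u3 c (X , X<3 , Y , Y<3 , t , _ , nontrivial , root , slope) = SimpleRoot⇒Soluble 1 u1 u2 u3 c record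
    { X = X ; Y = Y ; t = t
    ; nontrivial = ⊎-map (X<3 ,_) (Y<3 ,_) nontrivial
    ; root = root
    ; small-u3 = divides (U u3 2) (ℤP.*-comm (+ 9) (U u3 2))
    ; slope = slope }

case-1 : ∀ u1 u2 u3 c → HasVal (seq u1) 0 → HasVal (seq u2) 0 → HasVal (seq u3) 0 → ValGE c 2 →
  Soluble u1 u2 u3 c ⇔ PairCondition (r9 u1) (r9 u2) (r9 u3)
case-1 u1 u2 u3 c h1 h2 h3 c2 = mk⇔
  (λ s → necessary-1 u1 u2 u3 c h1 h2 h3 c2 (Soluble⇒Primitive u1 u2 u3 c s)) sufficient
  where
  sufficient : PairCondition (r9 u1) (r9 u2) (r9 u3) → Soluble u1 u2 u3 c
  sufficient (inj₁ p12) = Soluble-swap₂₃ u1 u2 u3 c (pair-soluble u1 u3 u2 c h1 h2 p12)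
  sufficient (inj₂ (inj₁ p13)) = pair-soluble u1 u2 u3 c h1 h3 p13
  sufficient (inj₂ (inj₂ p23)) = Soluble-swap₁₂ u1 u2 u3 c (pair-soluble u2 u1 u3 c h2 h3 p23)

case-2 : ∀ u1 u2 u3 c {v3} → HasVal (seq u1) 0 → HasVal (seq u2) 0 → HasVal (seq u3) v3 → 0 < v3 → v3 ≤ 2 →
  ValGE c 2 → Soluble u1 u2 u3 c ⇔ ((r9 u1 ≡±₉ r9 u2) ⊎ v3 ≡ 1)
case-2 u1 u2 u3 c {v3} h1 h2 h3 0<v3 v3≤2 c2 = mk⇔ necessary sufficient
  where
  necessary : Soluble u1 u2 u3 c → (r9 u1 ≡±₉ r9 u2) ⊎ v3 ≡ 1
  necessary s with v3 ℕ.≟ 1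
  ... | yes v3≡1 = inj₂ v3≡1
  ... | no v3≢1 = inj₁ (necessary-2 u1 u2 u3 c h1 h2 (subst (HasVal (seq u3)) v3≡2 h3) c2 (Soluble⇒Primitive u1 u2 u3 c s))
    where
    v3≡2 : v3 ≡ 2
    v3≡2 = ℕP.≤-antisym v3≤2 (ℕP.≤∧≢⇒< 0<v3 (λ 1≡v3 → v3≢1 (sym 1≡v3)))
  sufficient : (r9 u1 ≡±₉ r9 u2) ⊎ v3 ≡ 1 → Soluble u1 u2 u3 c
  sufficient (inj₁ p12) = Soluble-swap₂₃ u1 u2 u3 c (pair-soluble u1 u3 u2 c h1 h2 p12)
  sufficient (inj₂ refl) = Soluble-swap₁₃ u1 u2 u3 c (mod9-root-soluble u3 u2 u1 c
    (subst (SimpleRootMod9 (seq u3 2) (seq u2 2) (seq u1 2)) (sym c2)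
      (units-val1-root (bounded u1 2) (unit-mod9 u1 h1) (bounded u2 2) (unit-mod9 u2 h2)
        (bounded u3 2) (seq-div3 u3 2 (HasVal⇒zero u3 h3 ℕP.≤-refl)) (HasVal⇒nonzero u3 h3 ℕP.≤-refl))))

case-3 : ∀ u1 u2 u3 c → HasVal (seq u1) 0 → HasVal (seq u2) 1 → HasVal (seq u3) 1 → ValGE c 2 →
  Soluble u1 u2 u3 c ⇔ (r9/3 u2 ≡±₉ r9/3 u3)
case-3 u1 u2 u3 c h1 h2 h3 c2 = mk⇔
  (λ s → necessary-3 u1 u2 u3 c h1 h2 h3 c2 (Soluble⇒Primitive u1 u2 u3 c s))
  (val1-pair-soluble u1 u2 u3 c h2 h3)

case-4 : ∀ u1 u2 u3 c {v3} → HasVal (seq u1) 0 → HasVal (seq u2) 0 → HasVal (seq u3) v3 → 0 < v3 → v3 ≤ 2 →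
  HasVal (seq c) 1 → Soluble u1 u2 u3 c ⇔ ((r9 u1 ≡±₉ r9 u2) ⊎ SignCondition (r9 u1) (r9 u2) (r9 u3) (r9 c))
case-4 u1 u2 u3 c h1 h2 h3 0<v3 v3≤2 hc = mk⇔
  (λ s → necessary-4 u1 u2 u3 c h1 h2 h3 0<v3 v3≤2 hc (Soluble⇒Primitive u1 u2 u3 c s)) sufficient
  where
  sufficient : (r9 u1 ≡±₉ r9 u2) ⊎ SignCondition (r9 u1) (r9 u2) (r9 u3) (r9 c) → Soluble u1 u2 u3 c
  sufficient (inj₁ p12) = Soluble-swap₂₃ u1 u2 u3 c (pair-soluble u1 u3 u2 c h1 h2 p12)
  sufficient (inj₂ sign) = mod9-root-soluble u1 u2 u3 c
    (sign-root (bounded u1 2) (unit-mod9 u1 h1) (bounded u2 2) (unit-mod9 u2 h2)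
      (bounded u3 2) (seq-div3 u3 2 (HasVal⇒zero u3 h3 0<v3))
      (bounded c 2) (seq-div3 c 2 (HasVal⇒zero c hc ℕP.≤-refl)) (HasVal⇒nonzero c hc ℕP.≤-refl) sign)

case-5 : ∀ u1 u2 u3 c → HasVal (seq u1) 0 → HasVal (seq u2) 1 → HasVal (seq u3) 1 → HasVal (seq c) 1 →
  Soluble u1 u2 u3 c
case-5 u1 u2 u3 c h1 h2 h3 hc = Soluble-swap₁₃ u1 u2 u3 c (mod9-root-soluble u3 u2 u1 c
  (val1-root (bounded u1 2) (unit-mod9 u1 h1)
    (bounded u2 2) (seq-div3 u2 2 (HasVal⇒zero u2 h2 ℕP.≤-refl)) (HasVal⇒nonzero u2 h2 ℕP.≤-refl)
    (bounded u3 2) (seq-div3 u3 2 (HasVal⇒zero u3 h3 ℕP.≤-refl)) (HasVal⇒nonzero u3 h3 ℕP.≤-refl)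
    (bounded c 2) (seq-div3 c 2 (HasVal⇒zero c hc ℕP.≤-refl)) (HasVal⇒nonzero c hc ℕP.≤-refl)))

-- Lemma 5.9.  Reducedness bounds v(u3) by v(u1 u2 u3) ≤ 2; each part is then one of the five cases.
lemma5p9 :
  (u1 u2 u3 c : ℤ₃) (v2 v3 w : ℕ) →
  ValGE c 1 →
  HasVal (seq u1) 0 → HasVal (seq u2) v2 → HasVal (seq u3) v3 →
  v2 ≤ v3 →
  HasVal (prod3 u1 u2 u3) w → w ≤ 2 →
  (ValGE c 2 → w ≡ 0 →
     Soluble u1 u2 u3 c ⇔
       ((r9 u1 ≡±₉ r9 u2) ⊎ (r9 u1 ≡±₉ r9 u3) ⊎ (r9 u2 ≡±₉ r9 u3)))
  × (ValGE c 2 → v2 ≡ 0 → v3 > 0 →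
     Soluble u1 u2 u3 c ⇔ ((r9 u1 ≡±₉ r9 u2) ⊎ v3 ≡ 1))
  × (ValGE c 2 → v2 ≡ 1 → v3 ≡ 1 →
     Soluble u1 u2 u3 c ⇔ (r9/3 u2 ≡±₉ r9/3 u3))
  × (HasVal (seq c) 1 → v2 ≡ 0 → v3 > 0 →
     Soluble u1 u2 u3 c ⇔
       ((r9 u1 ≡±₉ r9 u2)
        ⊎ (∃[ s1 ] ∃[ s2 ] (IsSign s1 × IsSign s2 ×
             (r9 c ≡₉ (s1 ℤ.* r9 u1 ℤ.+ s2 ℤ.* r9 u2 ℤ.+ (s1 ℤ.* s2) ℤ.* r9 u3))))))
  × (HasVal (seq c) 1 → v2 ≡ 1 → v3 ≡ 1 →
     Soluble u1 u2 u3 c)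
lemma5p9 u1 u2 u3 c v2 v3 w _ h1 h2 h3 v2≤v3 hw w≤2 =
    (λ c2 w≡0 → case-1 u1 u2 u3 c h1 (subst (HasVal (seq u2)) (v2≡0 w≡0) h2) (subst (HasVal (seq u3)) (v3≡0 w≡0) h3) c2)
  , (λ c2 v2≡0 0<v3 → case-2 u1 u2 u3 c h1 (subst (HasVal (seq u2)) v2≡0 h2) h3 0<v3 v3≤2 c2)
  , (λ c2 v2≡1 v3≡1 → case-3 u1 u2 u3 c h1 (subst (HasVal (seq u2)) v2≡1 h2) (subst (HasVal (seq u3)) v3≡1 h3) c2)
  , (λ hc v2≡0 0<v3 → case-4 u1 u2 u3 c h1 (subst (HasVal (seq u2)) v2≡0 h2) h3 0<v3 v3≤2 hc)
  , (λ hc v2≡1 v3≡1 → case-5 u1 u2 u3 c h1 (subst (HasVal (seq u2)) v2≡1 h2) (subst (HasVal (seq u3)) v3≡1 h3) hc)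
  where
  v3≤w : v3 ≤ w
  v3≤w = val-≤-prod u1 u2 u3 h3 hw
  v3≤2 : v3 ≤ 2
  v3≤2 = ℕP.≤-trans v3≤w w≤2
  v3≡0 : w ≡ 0 → v3 ≡ 0
  v3≡0 w≡0 = ℕP.n≤0⇒n≡0 (subst (v3 ≤_) w≡0 v3≤w)
  v2≡0 : w ≡ 0 → v2 ≡ 0
  v2≡0 w≡0 = ℕP.n≤0⇒n≡0 (subst (v2 ≤_) (v3≡0 w≡0) v2≤v3)
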